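{- Let $\cdot\vdash P::\Gamma$ be derivable in CHOP (empty process environment). Then $\cdot\vdash[\![P]\!]::[\![\Gamma]\!]$ is derivable in CP.
   Context: CHOP (Classical Higher-Order Processes). Channel names $x,y,z,\dots$; process variables $p,q,r$; parameter labels $l$; type variables $X$. A parameter record $\rho=\{l_1=x_1,\dots,l_k=x_k\}$ maps distinct labels to channels. Processes: $x[y].(P\mid Q)\mid x(y).P\mid x[\mathsf{inl}].P\mid x[\mathsf{inr}].P\mid x.\mathsf{case}(P,Q)\mid ?x[y].P\mid !x(y).P\mid x[A].P\mid x(X).P\mid x[\lambda\rho.P]$ (send an abstraction, which binds the image of $\rho$, required to be exactly the free channels of $P$) $\mid x(p).P$ (receive abstraction into $p$) $\mid p\langle\rho\rangle$ (run) $\mid x[\,]\mid x().P\mid x.\mathsf{case}()\mid x\leftrightarrow^A y\mid(\nu x^Ay)(P\mid Q)\mid\mathsf{let}\ p=\lambda\rho.Q\ \mathsf{in}\ P$ (explicit substitution). In $x[y].(P\mid Q)$, $x(y).P$, $?x[y].P$, $!x(y).P$, $y$ is bound in $P$. Session types: $A\otimes B\mid A⅋B\mid A\oplus B\mid A\&B\mid0\mid\top\mid1\mid\bot\mid ?A\mid !A\mid\exists X.A\mid\forall X.A\mid X\mid X^\perp\mid\mathsf{send}(\Gamma)\mid\mathsf{recv}(\Gamma)$; a process type $\Gamma=s_1:A_1,\dots,s_n:A_n$ maps distinct keys (labels or channels) to types, order irrelevant. Duality $A^\perp$ is the standard linear-logic duality ($\otimes/⅋$, $\oplus/\&$, $0/\top$,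 $1/\bot$, $?/!$, $\exists/\forall$, $X/X^\perp$ swapped, e.g. $(A\otimes B)^\perp=A^\perp⅋B^\perp$, $(?A)^\perp=!(A^\perp)$) extended by $\mathsf{send}(\Gamma)^\perp=\mathsf{recv}(\Gamma)$ and $\mathsf{recv}(\Gamma)^\perp=\mathsf{send}(\Gamma)$. $\Gamma\rho$ renames labels via $\rho$; $?\Gamma$ means all types in $\Gamma$ are of form $?A$. A process environment $\Theta=p_1:\Gamma_1,\dots,p_n:\Gamma_n$ (distinct variables); $\cdot$ empty. CHOP typing rules for $\Theta\vdash P::\Gamma$: (Axiom) $\cdot\vdash x\leftrightarrow^A y::x:A^\perp,y:A$. (Cut) $\Theta\vdash P::\Gamma,x:A$, $\Theta'\vdash Q::\Delta,y:A^\perp$ give $\Theta,\Theta'\vdash(\nu x^Ay)(P\mid Q)::\Gamma,\Delta$. ($\otimes$) $\Theta\vdash P::\Gamma,y:A$, $\Theta'\vdash Q::\Delta,x:B$ give $\Theta,\Theta'\vdash x[y].(P\mid Q)::\Gamma,\Delta,x:A\otimes B$. ($⅋$) $\Theta\vdash P::\Gamma,y:A,x:B$ gives $\Theta\vdash x(y).P::\Gamma,x:A⅋B$. ($\oplus_{1,2}$) $\Theta\vdash P::\Gamma,x:A$ (resp. $B$) gives $\Theta\vdash x[\mathsf{inl}].P$ (resp. $x[\mathsf{inr}].P$) $::\Gamma,x:A\oplus B$. ($\&$) $\Theta\vdash P::\Gamma,x:A$, $\Theta\vdash Q::\Gamma,x:B$ give $\Theta\vdash x.\mathsf{case}(P,Q)::\Gamma,x:A\&B$.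 ($?$) $\Theta\vdash P::\Gamma,y:A$ gives $\Theta\vdash ?x[y].P::\Gamma,x:?A$. ($!$) $\cdot\vdash P::?\Gamma,y:A$ gives $\cdot\vdash !x(y).P::?\Gamma,x:!A$. ($\exists$) $\Theta\vdash P::\Gamma,x:B\{A/X\}$ gives $\Theta\vdash x[A].P::\Gamma,x:\exists X.B$. ($\forall$) $\Theta\vdash P::\Gamma,x:B$, $X$ not free in $\Theta,\Gamma$, gives $\Theta\vdash x(X).P::\Gamma,x:\forall X.B$. (Weaken) $\Theta\vdash P::\Gamma$ gives $\Theta\vdash P::\Gamma,x:?A$. (Contract) $\Theta\vdash P::\Gamma,y:?A,z:?A$ gives $\Theta\vdash P\{x/y,x/z\}::\Gamma,x:?A$. ($1$) $\cdot\vdash x[\,]::x:1$. ($\bot$) $\Theta\vdash P::\Gamma$ gives $\Theta\vdash x().P::\Gamma,x:\bot$. ($\top$) $\Theta\vdash x.\mathsf{case}()::\Gamma,x:\top$. (Id) $p:\Gamma\vdash p\langle\rho\rangle::\Gamma\rho$. (Chop) $\Theta\vdash P::\Delta\rho$, $\Theta',p:\Delta\vdash Q::\Gamma$ give $\Theta,\Theta'\vdash\mathsf{let}\ p=\lambda\rho.P\ \mathsf{in}\ Q::\Gamma$. ($\mathsf{send}$) $\Theta\vdash P::\Gamma\rho$ gives $\Theta\vdash x[\lambda\rho.P]::x:\mathsf{send}(\Gamma)$. ($\mathsf{recv}$) $\Theta,p:\Delta\vdash P::\Gamma$ gives $\Theta\vdash x(p).P::\Gamma,x:\mathsf{recv}(\Delta)$.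 CP is the fragment of CHOP without the types $\mathsf{send}(\Gamma),\mathsf{recv}(\Gamma)$, without the terms $x[\lambda\rho.P]$, $x(p).P$, $p\langle\rho\rangle$ and explicit substitutions, whose typing rules are those above except Id, Chop, $\mathsf{send}$, $\mathsf{recv}$, with the process environment removed (always empty). In CP, free output $x[y].P$ abbreviates $x[z].(y\leftrightarrow z\mid P)$ ($z$ fresh). Type translation: $[\![\mathsf{send}(\Delta)]\!]=([\![\Delta]\!])^\perp\otimes 1$; $[\![\mathsf{recv}(\Delta)]\!]=[\![\Delta]\!]⅋\bot$; for a label-keyed $\Delta=(l_1:A_1,\dots,l_n:A_n)$ with labels in lexicographic order, $[\![\Delta]\!]=[\![A_1^\perp]\!]\otimes\cdots\otimes[\![A_n^\perp]\!]\otimes 1$; all other connectives, units, atoms and quantifiers are translated homomorphically. For channel-keyed $\Gamma$, $[\![\Gamma]\!]$ translates each type pointwise. $\{x^p\}$ is a family of channel names, one per process variable $p$, not otherwise used. Process translation $[\![\cdot]\!]$, defined on CHOP typing derivations (records $\rho=\{l_1=z_1,\dots,l_k=z_k\}$ listed in lexicographic order of labels): Chop, $\mathsf{let}\ p=\lambda\rho.P\ \mathsf{in}\ Q$ $\mapsto(\nu x^p\,y^p)([\![Q]\!]\mid y^p(z_1).\cdots.y^p(z_k).y^p().[\![P]\!])$ (restriction typed $[\![\Delta]\!]$ where $p:\Delta$); Id $p\langle\rho\rangle\mapsto x^p[z_1].\cdots.x^p[z_k].x^p[\,]$ (free outputs); $\mathsf{send}$: $x[\lambda\rho.P]\mapsto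 x[y].(y(z_1).\cdots.y(z_k).y().[\![P]\!]\mid x[\,])$; $\mathsf{recv}$: $x(p).Q\mapsto x(x^p).x().[\![Q]\!]$; Axiom $x\leftrightarrow^A y\mapsto x\leftrightarrow^{[\![A]\!]}y$; Cut $(\nu x^Ay)(P\mid Q)\mapsto(\nu x^{[\![A]\!]}y)([\![P]\!]\mid[\![Q]\!])$; $\exists$: $x[A].P\mapsto x[[\![A]\!]].[\![P]\!]$; Weaken $\mapsto$ the translation of the premise; Contract $\mapsto$ the translation of the premise with $x$ substituted for $y$ and $z$; every other rule maps its term constructor to the same constructor applied to the translations of the premises. -}

module Defs where

open import Data.Nat using (ℕ; _≤?_)
open import Data.Nat.Properties using () renaming (_≟_ to _≟ℕ_)
open import Data.Bool using (Bool; true; false; if_then_else_; _∨_)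
open import Data.Product using (_×_; _,_; proj₁; proj₂)
open import Data.List using (List; []; _∷_; _++_; map; foldr)
open import Data.List.Membership.Propositional using (_∈_; _∉_)
open import Data.List.Relation.Unary.All using (All)
open import Data.List.Relation.Unary.Unique.Propositional using (Unique)
open import Data.List.Relation.Binary.Permutation.Propositional using (_↭_)
open import Relation.Nullary using (Dec; yes; no)
open import Relation.Nullary.Decidable using (⌊_⌋)
open import Relation.Binary.PropositionalEquality using (_≡_; _≢_; refl; cong)
open import Data.Unit using (⊤)

Ch : Set
Ch = ℕ
PVar : Set
PVar = ℕ
Label : Set     -- parameter labels (lexicographic order = order on ℕ)
Label = ℕ
TVar : Set
TVar = ℕ

keys : {A : Set} → List (ℕ × A) → List ℕ
keys = map proj₁

Distinct : {A : Set} → List (ℕ × A) → Set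
Distinct xs = Unique (keys xs)

insertK : {A : Set} → ℕ × A → List (ℕ × A) → List (ℕ × A)
insertK p [] = p ∷ []
insertK (k , a) ((k' , b) ∷ xs) with k ≤? k'
... | yes _ = (k , a) ∷ (k' , b) ∷ xs
... | no  _ = (k' , b) ∷ insertK (k , a) xs

sortK : {A : Set} → List (ℕ × A) → List (ℕ × A)
sortK = foldr insertK []

data Ty : Set where
  _⊗_ _⅋_ _⊕_ _&_ : Ty → Ty → Ty
  Zer Top One Bot : Ty
  ?' !' : Ty → Ty
  ∃' ∀' : TVar → Ty → Ty
  tv tv⊥ : TVar → Ty
  send recv : List (Label × Ty) → Ty

LCtx : Set
LCtx = List (Label × Ty)
CCtx : Set
CCtx = List (Ch × Ty)
Env : Set
Env = List (PVar × LCtx)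

dual : Ty → Ty
dual (A ⊗ B) = dual A ⅋ dual B
dual (A ⅋ B) = dual A ⊗ dual B
dual (A ⊕ B) = dual A & dual B
dual (A & B) = dual A ⊕ dual B
dual Zer = Top
dual Top = Zer
dual One = Bot
dual Bot = One
dual (?' A) = !' (dual A)
dual (!' A) = ?' (dual A)
dual (∃' X A) = ∀' X (dual A)
dual (∀' X A) = ∃' X (dual A)
dual (tv X) = tv⊥ X
dual (tv⊥ X) = tv X
dual (send Γ) = recv Γ
dual (recv Γ) = send Γ

-- B {A/X} (capture is excluded by a side condition in the ∃ rule)
mutual
  tsub : Ty → Ty → TVar → Ty
  tsub (B ⊗ C) A X = tsub B A X ⊗ tsub C A X
  tsub (B ⅋ C) A X = tsub B A X ⅋ tsub C A X
  tsub (B ⊕ C) A X = tsub B A X ⊕ tsub C A X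
  tsub (B & C) A X = tsub B A X & tsub C A X
  tsub Zer A X = Zer
  tsub Top A X = Top
  tsub One A X = One
  tsub Bot A X = Bot
  tsub (?' B) A X = ?' (tsub B A X)
  tsub (!' B) A X = !' (tsub B A X)
  tsub (∃' Y B) A X = if ⌊ X ≟ℕ Y ⌋ then ∃' Y B else ∃' Y (tsub B A X)
  tsub (∀' Y B) A X = if ⌊ X ≟ℕ Y ⌋ then ∀' Y B else ∀' Y (tsub B A X)
  tsub (tv Y) A X = if ⌊ X ≟ℕ Y ⌋ then A else tv Y
  tsub (tv⊥ Y) A X = if ⌊ X ≟ℕ Y ⌋ then dual A else tv⊥ Y
  tsub (send Γ) A X = send (tsubL Γ A X)
  tsub (recv Γ) A X = recv (tsubL Γ A X)

  tsubL : LCtx → Ty → TVar → LCtx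
  tsubL [] A X = []
  tsubL ((l , B) ∷ Γ) A X = (l , tsub B A X) ∷ tsubL Γ A X

mutual
  ftv : Ty → List TVar
  ftv (A ⊗ B) = ftv A ++ ftv B
  ftv (A ⅋ B) = ftv A ++ ftv B
  ftv (A ⊕ B) = ftv A ++ ftv B
  ftv (A & B) = ftv A ++ ftv B
  ftv Zer = []
  ftv Top = []
  ftv One = []
  ftv Bot = []
  ftv (?' A) = ftv A
  ftv (!' A) = ftv A
  ftv (∃' X A) = removeV X (ftv A)
  ftv (∀' X A) = removeV X (ftv A)
  ftv (tv X) = X ∷ []
  ftv (tv⊥ X) = X ∷ []
  ftv (send Γ) = ftvL Γ
  ftv (recv Γ) = ftvL Γ

  ftvL : List (ℕ × Ty) → List TVar
  ftvL [] = []
  ftvL ((_ , A) ∷ Γ) = ftv A ++ ftvL Γ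

  removeV : TVar → List TVar → List TVar
  removeV X [] = []
  removeV X (Y ∷ Ys) = if ⌊ X ≟ℕ Y ⌋ then removeV X Ys else Y ∷ removeV X Ys

ftvE : Env → List TVar
ftvE [] = []
ftvE ((_ , Δ) ∷ Θ) = ftvL Δ ++ ftvE Θ

mutual
  btv : Ty → List TVar
  btv (A ⊗ B) = btv A ++ btv B
  btv (A ⅋ B) = btv A ++ btv B
  btv (A ⊕ B) = btv A ++ btv B
  btv (A & B) = btv A ++ btv B
  btv Zer = []
  btv Top = []
  btv One = []
  btv Bot = []
  btv (?' A) = btv A
  btv (!' A) = btv A
  btv (∃' X A) = X ∷ btv A
  btv (∀' X A) = X ∷ btv A
  btv (tv X) = []
  btv (tv⊥ X) = []
  btv (send Γ) = btvL Γ
  btv (recv Γ) = btvL Γ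

  btvL : LCtx → List TVar
  btvL [] = []
  btvL ((_ , A) ∷ Γ) = btv A ++ btvL Γ

mutual
  WfTy : Ty → Set
  WfTy (A ⊗ B) = WfTy A × WfTy B
  WfTy (A ⅋ B) = WfTy A × WfTy B
  WfTy (A ⊕ B) = WfTy A × WfTy B
  WfTy (A & B) = WfTy A × WfTy B
  WfTy Zer = ⊤
  WfTy Top = ⊤
  WfTy One = ⊤
  WfTy Bot = ⊤
  WfTy (?' A) = WfTy A
  WfTy (!' A) = WfTy A
  WfTy (∃' X A) = WfTy A
  WfTy (∀' X A) = WfTy A
  WfTy (tv X) = ⊤
  WfTy (tv⊥ X) = ⊤
  WfTy (send Γ) = WfL Γ
  WfTy (recv Γ) = WfL Γ

  WfL : List (ℕ × Ty) → Set
  WfL [] = ⊤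
  WfL ((k , A) ∷ Γ) = (k ∉ keys Γ) × WfTy A × WfL Γ

WfE : Env → Set
WfE [] = ⊤
WfE ((p , Δ) ∷ Θ) = (p ∉ keys Θ) × WfL Δ × WfE Θ

IsWhyNot : Ty → Set
IsWhyNot (?' A) = ⊤
IsWhyNot _ = Data.Empty.⊥
  where import Data.Empty

Record : Set
Record = List (Label × Ch)

data Proc : Set where
  out       : Ch → Ch → Proc → Proc → Proc        -- x[y].(P | Q)
  inp       : Ch → Ch → Proc → Proc
  inl inr   : Ch → Proc → Proc
  case      : Ch → Proc → Proc → Proc
  whyNot    : Ch → Ch → Proc → Proc
  bang      : Ch → Ch → Proc → Proc
  tout      : Ch → Ty → Proc → Proc
  tin       : Ch → TVar → Proc → Proc
  sendAbs   : Ch → Record → Proc → Proc           -- x[λρ.P]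
  recvAbs   : Ch → PVar → Proc → Proc             -- x(p).P
  run       : PVar → Record → Proc                -- p⟨ρ⟩
  close     : Ch → Proc
  wait      : Ch → Proc → Proc
  caseEmpty : Ch → Proc
  fwd       : Ch → Ty → Ch → Proc
  nu        : Ch → Ty → Ch → Proc → Proc → Proc   -- (ν x^A y)(P | Q)
  letP      : PVar → Record → Proc → Proc → Proc  -- let p = λρ.P in Q

image : Record → List Ch
image = map proj₂

bn : Proc → List Ch
bn (out x y P Q) = y ∷ bn P ++ bn Q
bn (inp x y P) = y ∷ bn P
bn (inl x P) = bn P
bn (inr x P) = bn P
bn (case x P Q) = bn P ++ bn Q
bn (whyNot x y P) = y ∷ bn P
bn (bang x y P) = y ∷ bn P
bn (tout x A P) = bn P
bn (tin x X P) = bn P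
bn (sendAbs x ρ P) = image ρ ++ bn P
bn (recvAbs x p P) = bn P
bn (run p ρ) = []
bn (close x) = []
bn (wait x P) = bn P
bn (caseEmpty x) = []
bn (fwd x A y) = []
bn (nu x A y P Q) = x ∷ y ∷ bn P ++ bn Q
bn (letP p ρ P Q) = image ρ ++ bn P ++ bn Q

-- renaming of free channel names (binders shadow)
mask : Ch → (Ch → Ch) → Ch → Ch
mask b f c = if ⌊ c ≟ℕ b ⌋ then c else f c

maskAll : List Ch → (Ch → Ch) → Ch → Ch
maskAll [] f = f
maskAll (b ∷ bs) f = mask b (maskAll bs f)

ren : (Ch → Ch) → Proc → Proc
ren f (out x y P Q) = out (f x) y (ren (mask y f) P) (ren f Q)
ren f (inp x y P) = inp (f x) y (ren (mask y f) P)
ren f (inl x P) = inl (f x) (ren f P)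
ren f (inr x P) = inr (f x) (ren f P)
ren f (case x P Q) = case (f x) (ren f P) (ren f Q)
ren f (whyNot x y P) = whyNot (f x) y (ren (mask y f) P)
ren f (bang x y P) = bang (f x) y (ren (mask y f) P)
ren f (tout x A P) = tout (f x) A (ren f P)
ren f (tin x X P) = tin (f x) X (ren f P)
ren f (sendAbs x ρ P) = sendAbs (f x) ρ (ren (maskAll (image ρ) f) P)
ren f (recvAbs x p P) = recvAbs (f x) p (ren f P)
ren f (run p ρ) = run p (map (λ lz → proj₁ lz , f (proj₂ lz)) ρ)
ren f (close x) = close (f x)
ren f (wait x P) = wait (f x) (ren f P)
ren f (caseEmpty x) = caseEmpty (f x)
ren f (fwd x A y) = fwd (f x) A (f y)
ren f (nu x A y P Q) = nu x A y (ren (mask x f) P) (ren (mask y f) Q)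
ren f (letP p ρ P Q) = letP p ρ (ren (maskAll (image ρ) f) P) (ren f Q)

sub2 : Ch → Ch → Ch → Ch → Ch
sub2 x y z c = if ⌊ c ≟ℕ y ⌋ ∨ ⌊ c ≟ℕ z ⌋ then x else c

RecFor : Record → LCtx → Set
RecFor ρ Δ = Unique (keys ρ) × (keys ρ ↭ keys Δ)

data Ren (ρ : Record) : LCtx → CCtx → Set where
  []  : Ren ρ [] []
  _∷_ : ∀ {l z A Δ Γ} → (l , z) ∈ ρ → Ren ρ Δ Γ → Ren ρ ((l , A) ∷ Δ) ((z , A) ∷ Γ)

infix 3 _⊢_⦂_

data _⊢_⦂_ : Env → Proc → CCtx → Set where
  Tax   : ∀ {x y A} → x ≢ y → WfTy A →
          [] ⊢ fwd x A y ⦂ (x , dual A) ∷ (y , A) ∷ []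
  Tcut  : ∀ {Θ Θ' P Q Γ Δ x y A} →
          Θ ⊢ P ⦂ (x , A) ∷ Γ → Θ' ⊢ Q ⦂ (y , dual A) ∷ Δ →
          WfE (Θ ++ Θ') → Distinct (Γ ++ Δ) → WfTy A →
          Θ ++ Θ' ⊢ nu x A y P Q ⦂ Γ ++ Δ
  T⊗    : ∀ {Θ Θ' P Q Γ Δ x y A B} →
          Θ ⊢ P ⦂ (y , A) ∷ Γ → Θ' ⊢ Q ⦂ (x , B) ∷ Δ →
          WfE (Θ ++ Θ') → Distinct ((x , A ⊗ B) ∷ Γ ++ Δ) →
          Θ ++ Θ' ⊢ out x y P Q ⦂ (x , A ⊗ B) ∷ Γ ++ Δ
  T⅋    : ∀ {Θ P Γ x y A B} →
          Θ ⊢ P ⦂ (y , A) ∷ (x , B) ∷ Γ →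
          Θ ⊢ inp x y P ⦂ (x , A ⅋ B) ∷ Γ
  T⊕₁   : ∀ {Θ P Γ x A B} → WfTy B →
          Θ ⊢ P ⦂ (x , A) ∷ Γ →
          Θ ⊢ inl x P ⦂ (x , A ⊕ B) ∷ Γ
  T⊕₂   : ∀ {Θ P Γ x A B} → WfTy A →
          Θ ⊢ P ⦂ (x , B) ∷ Γ →
          Θ ⊢ inr x P ⦂ (x , A ⊕ B) ∷ Γ
  T&    : ∀ {Θ P Q Γ x A B} →
          Θ ⊢ P ⦂ (x , A) ∷ Γ → Θ ⊢ Q ⦂ (x , B) ∷ Γ →
          Θ ⊢ case x P Q ⦂ (x , A & B) ∷ Γ
  T?    : ∀ {Θ P Γ x y A} →
          Θ ⊢ P ⦂ (y , A) ∷ Γ → x ∉ keys Γ →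
          Θ ⊢ whyNot x y P ⦂ (x , ?' A) ∷ Γ
  T!    : ∀ {P Γ x y A} →
          [] ⊢ P ⦂ (y , A) ∷ Γ → All (λ xB → IsWhyNot (proj₂ xB)) Γ → x ∉ keys Γ →
          [] ⊢ bang x y P ⦂ (x , !' A) ∷ Γ
  T∃    : ∀ {Θ P Γ x X A B} → WfTy A →
          All (λ Y → Y ∉ btv B) (ftv A) →      -- B{A/X} is capture-free
          Θ ⊢ P ⦂ (x , tsub B A X) ∷ Γ →
          Θ ⊢ tout x A P ⦂ (x , ∃' X B) ∷ Γ
  T∀    : ∀ {Θ P Γ x X B} →
          Θ ⊢ P ⦂ (x , B) ∷ Γ → X ∉ ftvL Γ → X ∉ ftvE Θ →
          Θ ⊢ tin x X P ⦂ (x , ∀' X B) ∷ Γ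
  Tweak : ∀ {Θ P Γ x A} → WfTy A →
          Θ ⊢ P ⦂ Γ → x ∉ keys Γ →
          Θ ⊢ P ⦂ (x , ?' A) ∷ Γ
  Tcon  : ∀ {Θ P Γ x y z A} →
          Θ ⊢ P ⦂ (y , ?' A) ∷ (z , ?' A) ∷ Γ → x ∉ keys Γ →
          x ∉ bn P →                            -- no capture of x
          Θ ⊢ ren (sub2 x y z) P ⦂ (x , ?' A) ∷ Γ
  T𝟏    : ∀ {x} → [] ⊢ close x ⦂ (x , One) ∷ []
  T⊥    : ∀ {Θ P Γ x} →
          Θ ⊢ P ⦂ Γ → x ∉ keys Γ →
          Θ ⊢ wait x P ⦂ (x , Bot) ∷ Γ
  T⊤    : ∀ {Θ Γ x} → WfE Θ → WfL ((x , Top) ∷ Γ) →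
          Θ ⊢ caseEmpty x ⦂ (x , Top) ∷ Γ
  Tid   : ∀ {p ρ Γ Γρ} → WfL Γ → RecFor ρ Γ → Ren ρ Γ Γρ → Distinct Γρ →
          (p , Γ) ∷ [] ⊢ run p ρ ⦂ Γρ
  Tchop : ∀ {Θ Θ' P Q Γ Δ Δρ p ρ} →
          RecFor ρ Δ → Ren ρ Δ Δρ → Θ ⊢ P ⦂ Δρ →
          (p , Δ) ∷ Θ' ⊢ Q ⦂ Γ → WfE (Θ ++ Θ') →
          Θ ++ Θ' ⊢ letP p ρ P Q ⦂ Γ
  Tsend : ∀ {Θ P Γ Γρ x ρ} →
          RecFor ρ Γ → Ren ρ Γ Γρ → Θ ⊢ P ⦂ Γρ →
          Θ ⊢ sendAbs x ρ P ⦂ (x , send Γ) ∷ []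
  Trecv : ∀ {Θ P Γ Δ x p} →
          (p , Δ) ∷ Θ ⊢ P ⦂ Γ → x ∉ keys Γ →
          Θ ⊢ recvAbs x p P ⦂ (x , recv Δ) ∷ Γ
  Texch : ∀ {Θ Θ' P Γ Γ'} → Θ ↭ Θ' → Γ ↭ Γ' →
          Θ ⊢ P ⦂ Γ → Θ' ⊢ P ⦂ Γ'

data CTy : Set where
  _⊗_ _⅋_ _⊕_ _&_ : CTy → CTy → CTy
  Zer Top One Bot : CTy
  ?' !' : CTy → CTy
  ∃' ∀' : TVar → CTy → CTy
  tv tv⊥ : TVar → CTy

cdual : CTy → CTy
cdual (A ⊗ B) = cdual A ⅋ cdual B
cdual (A ⅋ B) = cdual A ⊗ cdual B
cdual (A ⊕ B) = cdual A & cdual B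
cdual (A & B) = cdual A ⊕ cdual B
cdual Zer = Top
cdual Top = Zer
cdual One = Bot
cdual Bot = One
cdual (?' A) = !' (cdual A)
cdual (!' A) = ?' (cdual A)
cdual (∃' X A) = ∀' X (cdual A)
cdual (∀' X A) = ∃' X (cdual A)
cdual (tv X) = tv⊥ X
cdual (tv⊥ X) = tv X

ctsub : CTy → CTy → TVar → CTy
ctsub (B ⊗ C) A X = ctsub B A X ⊗ ctsub C A X
ctsub (B ⅋ C) A X = ctsub B A X ⅋ ctsub C A X
ctsub (B ⊕ C) A X = ctsub B A X ⊕ ctsub C A X
ctsub (B & C) A X = ctsub B A X & ctsub C A X
ctsub Zer A X = Zer
ctsub Top A X = Top
ctsub One A X = One
ctsub Bot A X = Bot
ctsub (?' B) A X = ?' (ctsub B A X)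
ctsub (!' B) A X = !' (ctsub B A X)
ctsub (∃' Y B) A X = if ⌊ X ≟ℕ Y ⌋ then ∃' Y B else ∃' Y (ctsub B A X)
ctsub (∀' Y B) A X = if ⌊ X ≟ℕ Y ⌋ then ∀' Y B else ∀' Y (ctsub B A X)
ctsub (tv Y) A X = if ⌊ X ≟ℕ Y ⌋ then A else tv Y
ctsub (tv⊥ Y) A X = if ⌊ X ≟ℕ Y ⌋ then cdual A else tv⊥ Y

cftv : CTy → List TVar
cftv (A ⊗ B) = cftv A ++ cftv B
cftv (A ⅋ B) = cftv A ++ cftv B
cftv (A ⊕ B) = cftv A ++ cftv B
cftv (A & B) = cftv A ++ cftv B
cftv Zer = []
cftv Top = []
cftv One = []
cftv Bot = []
cftv (?' A) = cftv A
cftv (!' A) = cftv A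
cftv (∃' X A) = removeV X (cftv A)
cftv (∀' X A) = removeV X (cftv A)
cftv (tv X) = X ∷ []
cftv (tv⊥ X) = X ∷ []

cbtv : CTy → List TVar
cbtv (A ⊗ B) = cbtv A ++ cbtv B
cbtv (A ⅋ B) = cbtv A ++ cbtv B
cbtv (A ⊕ B) = cbtv A ++ cbtv B
cbtv (A & B) = cbtv A ++ cbtv B
cbtv Zer = []
cbtv Top = []
cbtv One = []
cbtv Bot = []
cbtv (?' A) = cbtv A
cbtv (!' A) = cbtv A
cbtv (∃' X A) = X ∷ cbtv A
cbtv (∀' X A) = X ∷ cbtv A
cbtv (tv X) = []
cbtv (tv⊥ X) = []

CIsWhyNot : CTy → Set
CIsWhyNot (?' A) = ⊤
CIsWhyNot _ = Data.Empty.⊥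
  where import Data.Empty

-- CP channel names: the CHOP channels, the families x^p, y^p, and one
-- further name used for the fresh bound names introduced by the
-- translation (free output and send).

data Name : Set where
  ch    : Ch → Name
  xᵖ yᵖ : PVar → Name
  fresh : Name

_≟N_ : (a b : Name) → Dec (a ≡ b)
ch m ≟N ch n with m ≟ℕ n
... | yes refl = yes refl
... | no ne = no (λ { refl → ne refl })
ch _ ≟N xᵖ _ = no (λ ())
ch _ ≟N yᵖ _ = no (λ ())
ch _ ≟N fresh = no (λ ())
xᵖ _ ≟N ch _ = no (λ ())
xᵖ m ≟N xᵖ n with m ≟ℕ n
... | yes refl = yes refl
... | no ne = no (λ { refl → ne refl })
xᵖ _ ≟N yᵖ _ = no (λ ())
xᵖ _ ≟N fresh = no (λ ())
yᵖ _ ≟N ch _ = no (λ ())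
yᵖ _ ≟N xᵖ _ = no (λ ())
yᵖ m ≟N yᵖ n with m ≟ℕ n
... | yes refl = yes refl
... | no ne = no (λ { refl → ne refl })
yᵖ _ ≟N fresh = no (λ ())
fresh ≟N ch _ = no (λ ())
fresh ≟N xᵖ _ = no (λ ())
fresh ≟N yᵖ _ = no (λ ())
fresh ≟N fresh = yes refl

data CProc : Set where
  out       : Name → Name → CProc → CProc → CProc
  inp       : Name → Name → CProc → CProc
  inl inr   : Name → CProc → CProc
  case      : Name → CProc → CProc → CProc
  whyNot    : Name → Name → CProc → CProc
  bang      : Name → Name → CProc → CProc
  tout      : Name → CTy → CProc → CProc
  tin       : Name → TVar → CProc → CProc
  close     : Name → CProc
  wait      : Name → CProc → CProc
  caseEmpty : Name → CProc
  fwd       : Name → CTy → Name → CProc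
  nu        : Name → CTy → Name → CProc → CProc → CProc

cbn : CProc → List Name
cbn (out x y P Q) = y ∷ cbn P ++ cbn Q
cbn (inp x y P) = y ∷ cbn P
cbn (inl x P) = cbn P
cbn (inr x P) = cbn P
cbn (case x P Q) = cbn P ++ cbn Q
cbn (whyNot x y P) = y ∷ cbn P
cbn (bang x y P) = y ∷ cbn P
cbn (tout x A P) = cbn P
cbn (tin x X P) = cbn P
cbn (close x) = []
cbn (wait x P) = cbn P
cbn (caseEmpty x) = []
cbn (fwd x A y) = []
cbn (nu x A y P Q) = x ∷ y ∷ cbn P ++ cbn Q

cmask : Name → (Name → Name) → Name → Name
cmask b f c = if ⌊ c ≟N b ⌋ then c else f c

cren : (Name → Name) → CProc → CProc
cren f (out x y P Q) = out (f x) y (cren (cmask y f) P) (cren f Q)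
cren f (inp x y P) = inp (f x) y (cren (cmask y f) P)
cren f (inl x P) = inl (f x) (cren f P)
cren f (inr x P) = inr (f x) (cren f P)
cren f (case x P Q) = case (f x) (cren f P) (cren f Q)
cren f (whyNot x y P) = whyNot (f x) y (cren (cmask y f) P)
cren f (bang x y P) = bang (f x) y (cren (cmask y f) P)
cren f (tout x A P) = tout (f x) A (cren f P)
cren f (tin x X P) = tin (f x) X (cren f P)
cren f (close x) = close (f x)
cren f (wait x P) = wait (f x) (cren f P)
cren f (caseEmpty x) = caseEmpty (f x)
cren f (fwd x A y) = fwd (f x) A (f y)
cren f (nu x A y P Q) = nu x A y (cren (cmask x f) P) (cren (cmask y f) Q)

csub2 : Name → Name → Name → Name → Name
csub2 x y z c = if ⌊ c ≟N y ⌋ ∨ ⌊ c ≟N z ⌋ then x else c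

CCtxCP : Set
CCtxCP = List (Name × CTy)

ckeys : CCtxCP → List Name
ckeys = map proj₁

CDistinct : CCtxCP → Set
CDistinct Γ = Unique (ckeys Γ)

cftvL : CCtxCP → List TVar
cftvL [] = []
cftvL ((_ , A) ∷ Γ) = cftv A ++ cftvL Γ

infix 3 ⊢ᶜ_⦂_

data ⊢ᶜ_⦂_ : CProc → CCtxCP → Set where
  Cax   : ∀ {x y A} → x ≢ y →
          ⊢ᶜ fwd x A y ⦂ (x , cdual A) ∷ (y , A) ∷ []
  Ccut  : ∀ {P Q Γ Δ x y A} →
          ⊢ᶜ P ⦂ (x , A) ∷ Γ → ⊢ᶜ Q ⦂ (y , cdual A) ∷ Δ →
          CDistinct (Γ ++ Δ) →
          ⊢ᶜ nu x A y P Q ⦂ Γ ++ Δ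
  C⊗    : ∀ {P Q Γ Δ x y A B} →
          ⊢ᶜ P ⦂ (y , A) ∷ Γ → ⊢ᶜ Q ⦂ (x , B) ∷ Δ →
          CDistinct ((x , A ⊗ B) ∷ Γ ++ Δ) →
          ⊢ᶜ out x y P Q ⦂ (x , A ⊗ B) ∷ Γ ++ Δ
  C⅋    : ∀ {P Γ x y A B} →
          ⊢ᶜ P ⦂ (y , A) ∷ (x , B) ∷ Γ →
          ⊢ᶜ inp x y P ⦂ (x , A ⅋ B) ∷ Γ
  C⊕₁   : ∀ {P Γ x A B} →
          ⊢ᶜ P ⦂ (x , A) ∷ Γ →
          ⊢ᶜ inl x P ⦂ (x , A ⊕ B) ∷ Γ
  C⊕₂   : ∀ {P Γ x A B} →
          ⊢ᶜ P ⦂ (x , B) ∷ Γ →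
          ⊢ᶜ inr x P ⦂ (x , A ⊕ B) ∷ Γ
  C&    : ∀ {P Q Γ x A B} →
          ⊢ᶜ P ⦂ (x , A) ∷ Γ → ⊢ᶜ Q ⦂ (x , B) ∷ Γ →
          ⊢ᶜ case x P Q ⦂ (x , A & B) ∷ Γ
  C?    : ∀ {P Γ x y A} →
          ⊢ᶜ P ⦂ (y , A) ∷ Γ → x ∉ ckeys Γ →
          ⊢ᶜ whyNot x y P ⦂ (x , ?' A) ∷ Γ
  C!    : ∀ {P Γ x y A} →
          ⊢ᶜ P ⦂ (y , A) ∷ Γ → All (λ xB → CIsWhyNot (proj₂ xB)) Γ → x ∉ ckeys Γ →
          ⊢ᶜ bang x y P ⦂ (x , !' A) ∷ Γ
  C∃    : ∀ {P Γ x X A B} →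
          All (λ Y → Y ∉ cbtv B) (cftv A) →     -- B{A/X} is capture-free
          ⊢ᶜ P ⦂ (x , ctsub B A X) ∷ Γ →
          ⊢ᶜ tout x A P ⦂ (x , ∃' X B) ∷ Γ
  C∀    : ∀ {P Γ x X B} →
          ⊢ᶜ P ⦂ (x , B) ∷ Γ → X ∉ cftvL Γ →
          ⊢ᶜ tin x X P ⦂ (x , ∀' X B) ∷ Γ
  Cweak : ∀ {P Γ x A} →
          ⊢ᶜ P ⦂ Γ → x ∉ ckeys Γ →
          ⊢ᶜ P ⦂ (x , ?' A) ∷ Γ
  Ccon  : ∀ {P Γ x y z A} →
          ⊢ᶜ P ⦂ (y , ?' A) ∷ (z , ?' A) ∷ Γ → x ∉ ckeys Γ →
          x ∉ cbn P →                            -- no capture of x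
          ⊢ᶜ cren (csub2 x y z) P ⦂ (x , ?' A) ∷ Γ
  C𝟏    : ∀ {x} → ⊢ᶜ close x ⦂ (x , One) ∷ []
  C⊥    : ∀ {P Γ x} →
          ⊢ᶜ P ⦂ Γ → x ∉ ckeys Γ →
          ⊢ᶜ wait x P ⦂ (x , Bot) ∷ Γ
  C⊤    : ∀ {Γ x} → CDistinct ((x , Top) ∷ Γ) →
          ⊢ᶜ caseEmpty x ⦂ (x , Top) ∷ Γ
  Cexch : ∀ {P Γ Γ'} → Γ ↭ Γ' →
          ⊢ᶜ P ⦂ Γ → ⊢ᶜ P ⦂ Γ'

-- [[Δ]] for a (translated) label-keyed process type:
-- [[A₁^⊥]] ⊗ … ⊗ [[Aₙ^⊥]] ⊗ 1, labels in ascending order.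
-- (Here [[A^⊥]] is computed as cdual [[A]].)
lctx : List (Label × CTy) → CTy
lctx Δ = foldr (λ lB acc → cdual (proj₂ lB) ⊗ acc) One (sortK Δ)

mutual
  ⟦_⟧ : Ty → CTy
  ⟦ A ⊗ B ⟧ = ⟦ A ⟧ ⊗ ⟦ B ⟧
  ⟦ A ⅋ B ⟧ = ⟦ A ⟧ ⅋ ⟦ B ⟧
  ⟦ A ⊕ B ⟧ = ⟦ A ⟧ ⊕ ⟦ B ⟧
  ⟦ A & B ⟧ = ⟦ A ⟧ & ⟦ B ⟧
  ⟦ Zer ⟧ = Zer
  ⟦ Top ⟧ = Top
  ⟦ One ⟧ = One
  ⟦ Bot ⟧ = Bot
  ⟦ ?' A ⟧ = ?' ⟦ A ⟧
  ⟦ !' A ⟧ = !' ⟦ A ⟧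
  ⟦ ∃' X A ⟧ = ∃' X ⟦ A ⟧
  ⟦ ∀' X A ⟧ = ∀' X ⟦ A ⟧
  ⟦ tv X ⟧ = tv X
  ⟦ tv⊥ X ⟧ = tv⊥ X
  ⟦ send Δ ⟧ = cdual (lctx ⟦ Δ ⟧L) ⊗ One
  ⟦ recv Δ ⟧ = lctx ⟦ Δ ⟧L ⅋ Bot

  ⟦_⟧L : LCtx → List (Label × CTy)
  ⟦ [] ⟧L = []
  ⟦ (l , A) ∷ Δ ⟧L = (l , ⟦ A ⟧) ∷ ⟦ Δ ⟧L

⟦_⟧Δ : LCtx → CTy
⟦ Δ ⟧Δ = lctx ⟦ Δ ⟧L

⟦_⟧C : CCtx → CCtxCP
⟦ [] ⟧C = []
⟦ (x , A) ∷ Γ ⟧C = (ch x , ⟦ A ⟧) ∷ ⟦ Γ ⟧C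

inputs : Name → Record → CProc → CProc
inputs y [] P = wait y P
inputs y ((_ , z) ∷ ρ) P = inp y (ch z) (inputs y ρ P)

-- x^p[z₁].….x^p[zₖ].x^p[], with free output x[z].P := x[w].(z ↔^{[[A^⊥]]} w | P)
-- (the second list gives the translated types [[Aᵢ]] of the zᵢ, sorted by label)
outputs : PVar → Record → List (Label × CTy) → CProc
outputs p ((_ , z) ∷ ρ) ((_ , B) ∷ Γ) =
  out (xᵖ p) fresh (fwd (ch z) (cdual B) fresh) (outputs p ρ Γ)
outputs p _ _ = close (xᵖ p)

tr : ∀ {Θ P Γ} → Θ ⊢ P ⦂ Γ → CProc
tr (Tax {x} {y} {A} _ _) = fwd (ch x) ⟦ A ⟧ (ch y)
tr (Tcut {x = x} {y} {A} d e _ _ _) = nu (ch x) ⟦ A ⟧ (ch y) (tr d) (tr e)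
tr (T⊗ {x = x} {y} d e _ _) = out (ch x) (ch y) (tr d) (tr e)
tr (T⅋ {x = x} {y} d) = inp (ch x) (ch y) (tr d)
tr (T⊕₁ {x = x} _ d) = inl (ch x) (tr d)
tr (T⊕₂ {x = x} _ d) = inr (ch x) (tr d)
tr (T& {x = x} d e) = case (ch x) (tr d) (tr e)
tr (T? {x = x} {y} d _) = whyNot (ch x) (ch y) (tr d)
tr (T! {x = x} {y} d _ _) = bang (ch x) (ch y) (tr d)
tr (T∃ {x = x} {A = A} _ _ d) = tout (ch x) ⟦ A ⟧ (tr d)
tr (T∀ {x = x} {X} d _ _) = tin (ch x) X (tr d)
tr (Tweak _ d _) = tr d
tr (Tcon {x = x} {y} {z} d _ _) = cren (csub2 (ch x) (ch y) (ch z)) (tr d)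
tr (T𝟏 {x}) = close (ch x)
tr (T⊥ {x = x} d _) = wait (ch x) (tr d)
tr (T⊤ {x = x} _ _) = caseEmpty (ch x)
tr (Tid {p} {ρ} {Γ} _ _ _ _) = outputs p (sortK ρ) (sortK ⟦ Γ ⟧L)
tr (Tchop {Δ = Δ} {p = p} {ρ} _ _ d e _) =
  nu (xᵖ p) ⟦ Δ ⟧Δ (yᵖ p) (tr e) (inputs (yᵖ p) (sortK ρ) (tr d))
tr (Tsend {x = x} {ρ} _ _ d) =
  out (ch x) fresh (inputs fresh (sortK ρ) (tr d)) (close (ch x))
tr (Trecv {x = x} {p} d _) = inp (ch x) (xᵖ p) (wait (ch x) (tr d))
tr (Texch _ _ d) = tr d

-- The translation is compositional, so the corollary is the case Θ = · of an induction
-- over CHOP derivations that also translates the process environment: each p : Δ in Θ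
-- becomes the CP channel x^p of type ⟦Δ⟧, and Θ ⊢ P :: Γ goes to ⊢ ⟦P⟧ :: ⟦Γ⟧, ⟦Θ⟧.
-- Chop is then a cut of x^p against the chain of inputs y^p(z₁)…y^p().⟦P⟧, send an output
-- of such a chain, and Id the matching chain of free outputs on x^p.  The real work is to
-- align the record ρ with Δ: both are consumed in label order, and sorting by key is
-- invariant under permutations of key-unique lists.  The side conditions of CP (distinct
-- channels, fresh ∀-variables, capture-free ∃, no capture by contraction) transfer because
-- the translation creates no new free or bound type variables and no new bound channels.

module Submission where

open import Defs
open import Data.Nat using (ℕ; _≤?_; _≤_)
open import Data.Nat.Properties using (≤-antisym; ≤-trans; ≰⇒≥) renaming (_≟_ to _≟ℕ_)
open import Data.Product using (_×_; _,_; proj₁; proj₂; map₂)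
open import Data.List using (List; []; _∷_; _++_; map; foldr)
open import Data.List.Properties using (map-++; ++-identityʳ; ++-assoc)
open import Function using (_∘_)
open import Data.List.Membership.Propositional using (_∈_; _∉_)
open import Data.List.Membership.Propositional.Properties using (∈-map⁺; ∈-map⁻; ∈-∃++; ∈-++⁻; ∈-++⁺ˡ; ∈-++⁺ʳ)
open import Data.List.Relation.Unary.All as All using (All; []; _∷_)
open import Data.List.Relation.Unary.Any using (Any; here; there)
open import Data.List.Relation.Unary.All.Properties using (All¬⇒¬Any; ¬Any⇒All¬)
open import Data.List.Relation.Unary.AllPairs using ([]; _∷_)
open import Data.List.Relation.Unary.Unique.Propositional using (Unique)
import Data.List.Relation.Unary.Unique.Propositional.Properties as Unique
open import Data.List.Relation.Binary.Permutation.Propositional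
open import Data.List.Relation.Binary.Permutation.Propositional.Properties
  using (map⁺; shift; shifts; drop-∷; ↭-empty-inv; ∈-resp-↭; Any-resp-↭; ++⁺ˡ; ++⁺ʳ; ++⁺; ++-comm; ∷↭∷ʳ)
open import Data.List.Relation.Binary.Subset.Propositional using (_⊆_)
open import Data.List.Relation.Binary.Subset.Propositional.Properties using (xs⊆xs++ys) renaming (++⁺ to ⊆-++⁺)
import Data.List.Relation.Binary.Permutation.Setoid.Properties as Perm
open import Relation.Nullary using (Dec; yes; no; ¬_)
open import Relation.Binary.PropositionalEquality
  using (_≡_; _≢_; refl; cong; cong₂; sym; subst; subst₂; setoid; module ≡-Reasoning)
  renaming (trans to ≡-trans)
open import Data.Empty using (⊥-elim)
open import Data.Sum using (inj₁; inj₂)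
open import Data.Unit using (tt)

-- Sorting by key

Unique-resp-↭ : {A : Set} {xs ys : List A} → xs ↭ ys → Unique xs → Unique ys
Unique-resp-↭ {A} p = Perm.Unique-resp-↭ (setoid A) (↭⇒↭ₛ p)

keys-↭ : {A : Set} {xs ys : List (ℕ × A)} → xs ↭ ys → keys xs ↭ keys ys
keys-↭ = map⁺ proj₁

module _ {A : Set} {k k' : ℕ} {a b : A} {xs : List (ℕ × A)} where

  insertK-≤ : k ≤ k' → insertK (k , a) ((k' , b) ∷ xs) ≡ (k , a) ∷ (k' , b) ∷ xs
  insertK-≤ k≤k' with k ≤? k'
  ... | yes _ = refl
  ... | no k≰k' = ⊥-elim (k≰k' k≤k')

  insertK-≰ : ¬ k ≤ k' → insertK (k , a) ((k' , b) ∷ xs) ≡ (k' , b) ∷ insertK (k , a) xs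
  insertK-≰ k≰k' with k ≤? k'
  ... | yes k≤k' = ⊥-elim (k≰k' k≤k')
  ... | no _ = refl

insertK-<-comm : {A : Set} (a b : ℕ × A) (xs : List (ℕ × A)) →
  proj₁ a ≤ proj₁ b → ¬ proj₁ b ≤ proj₁ a →
  insertK a (insertK b xs) ≡ insertK b (insertK a xs)
insertK-<-comm a b [] a≤b b≰a = ≡-trans (insertK-≤ a≤b) (sym (insertK-≰ b≰a))
insertK-<-comm a@(ka , _) b@(kb , _) (c@(kc , _) ∷ xs) a≤b b≰a = by-cases (kb ≤? kc) (ka ≤? kc)
  where
  open ≡-Reasoning
  by-cases : Dec (kb ≤ kc) → Dec (ka ≤ kc) →
    insertK a (insertK b (c ∷ xs)) ≡ insertK b (insertK a (c ∷ xs))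
  by-cases (yes b≤c) _ = begin
    insertK a (insertK b (c ∷ xs))  ≡⟨ cong (insertK a) (insertK-≤ b≤c) ⟩
    insertK a (b ∷ c ∷ xs)          ≡⟨ insertK-≤ a≤b ⟩
    a ∷ b ∷ c ∷ xs                  ≡⟨ cong (a ∷_) (insertK-≤ b≤c) ⟨
    a ∷ insertK b (c ∷ xs)          ≡⟨ insertK-≰ b≰a ⟨
    insertK b (a ∷ c ∷ xs)          ≡⟨ cong (insertK b) (insertK-≤ (≤-trans a≤b b≤c)) ⟨
    insertK b (insertK a (c ∷ xs))  ∎
  by-cases (no b≰c) (yes a≤c) = begin
    insertK a (insertK b (c ∷ xs))  ≡⟨ cong (insertK a) (insertK-≰ b≰c) ⟩
    insertK a (c ∷ insertK b xs)    ≡⟨ insertK-≤ a≤c ⟩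
    a ∷ c ∷ insertK b xs            ≡⟨ cong (a ∷_) (insertK-≰ b≰c) ⟨
    a ∷ insertK b (c ∷ xs)          ≡⟨ insertK-≰ b≰a ⟨
    insertK b (a ∷ c ∷ xs)          ≡⟨ cong (insertK b) (insertK-≤ a≤c) ⟨
    insertK b (insertK a (c ∷ xs))  ∎
  by-cases (no b≰c) (no a≰c) = begin
    insertK a (insertK b (c ∷ xs))  ≡⟨ cong (insertK a) (insertK-≰ b≰c) ⟩
    insertK a (c ∷ insertK b xs)    ≡⟨ insertK-≰ a≰c ⟩
    c ∷ insertK a (insertK b xs)    ≡⟨ cong (c ∷_) (insertK-<-comm a b xs a≤b b≰a) ⟩
    c ∷ insertK b (insertK a xs)    ≡⟨ insertK-≰ b≰c ⟨
    insertK b (c ∷ insertK a xs)    ≡⟨ cong (insertK b) (insertK-≰ a≰c) ⟨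
    insertK b (insertK a (c ∷ xs))  ∎

insertK-comm : {A : Set} (a b : ℕ × A) (xs : List (ℕ × A)) → proj₁ a ≢ proj₁ b →
  insertK a (insertK b xs) ≡ insertK b (insertK a xs)
insertK-comm a@(ka , _) b@(kb , _) xs ka≢kb with ka ≤? kb | kb ≤? ka
... | yes a≤b | yes b≤a = ⊥-elim (ka≢kb (≤-antisym a≤b b≤a))
... | yes a≤b | no b≰a = insertK-<-comm a b xs a≤b b≰a
... | no a≰b | _ = sym (insertK-<-comm b a xs (≰⇒≥ a≰b) a≰b)

↭⇒sortK-≡ : {A : Set} {xs ys : List (ℕ × A)} → xs ↭ ys → Unique (keys xs) → sortK xs ≡ sortK ys
↭⇒sortK-≡ refl _ = refl
↭⇒sortK-≡ (prep x p) (_ ∷ u) = cong (insertK x) (↭⇒sortK-≡ p u)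
↭⇒sortK-≡ (swap {ys = ys} x y p) ((x≢y ∷ _) ∷ _ ∷ u) =
  ≡-trans (cong (λ zs → insertK x (insertK y zs)) (↭⇒sortK-≡ p u)) (insertK-comm x y (sortK ys) x≢y)
↭⇒sortK-≡ (trans p q) u = ≡-trans (↭⇒sortK-≡ p u) (↭⇒sortK-≡ q (Unique-resp-↭ (keys-↭ p) u))

insertK-↭ : {A : Set} (x : ℕ × A) (xs : List (ℕ × A)) → insertK x xs ↭ x ∷ xs
insertK-↭ x [] = refl
insertK-↭ (k , a) ((k' , b) ∷ xs) with k ≤? k'
... | yes _ = refl
... | no _ = trans (prep (k' , b) (insertK-↭ (k , a) xs)) (swap _ _ refl)

sortK-↭ : {A : Set} (xs : List (ℕ × A)) → sortK xs ↭ xs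
sortK-↭ [] = refl
sortK-↭ (x ∷ xs) = trans (insertK-↭ x (sortK xs)) (prep x (sortK-↭ xs))

insertK-map₂ : {A B : Set} (f : A → B) (x : ℕ × A) (xs : List (ℕ × A)) →
  insertK (map₂ f x) (map (map₂ f) xs) ≡ map (map₂ f) (insertK x xs)
insertK-map₂ f x [] = refl
insertK-map₂ f (k , a) ((k' , b) ∷ xs) with k ≤? k'
... | yes _ = refl
... | no _ = cong ((k' , f b) ∷_) (insertK-map₂ f (k , a) xs)

sortK-map₂ : {A B : Set} (f : A → B) (xs : List (ℕ × A)) →
  sortK (map (map₂ f) xs) ≡ map (map₂ f) (sortK xs)
sortK-map₂ f [] = refl
sortK-map₂ f (x ∷ xs) = ≡-trans (cong (insertK (map₂ f x)) (sortK-map₂ f xs)) (insertK-map₂ f x (sortK xs))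

⊆-sameKeys⇒↭ : {A : Set} {ρ : List (ℕ × A)} (xs : List (ℕ × A)) →
  Unique (keys ρ) → keys ρ ↭ keys xs → All (_∈ ρ) xs → xs ↭ ρ
⊆-sameKeys⇒↭ {ρ = []} [] _ _ _ = refl
⊆-sameKeys⇒↭ {ρ = _ ∷ _} [] _ keys↭ _ with ↭-empty-inv keys↭
... | ()
⊆-sameKeys⇒↭ (x@(k , _) ∷ xs) uρ keys↭ (x∈ρ ∷ xs⊆ρ) with ∈-∃++ x∈ρ
... | ρ₁ , ρ₂ , refl = trans (prep x (⊆-sameKeys⇒↭ xs uρ' keys↭' xs⊆ρ')) (↭-sym ρ↭)
  where
  ρ↭ : ρ₁ ++ x ∷ ρ₂ ↭ x ∷ ρ₁ ++ ρ₂
  ρ↭ = shift x ρ₁ ρ₂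
  uρ' : Unique (keys (ρ₁ ++ ρ₂))
  uρ' with Unique-resp-↭ (keys-↭ ρ↭) uρ
  ... | _ ∷ u = u
  keys↭' : keys (ρ₁ ++ ρ₂) ↭ keys xs
  keys↭' = drop-∷ (trans (↭-sym (keys-↭ ρ↭)) keys↭)
  k∉xs : k ∉ keys xs
  k∉xs with Unique-resp-↭ keys↭ uρ
  ... | k∉ ∷ _ = All¬⇒¬Any k∉
  xs⊆ρ' : All (_∈ ρ₁ ++ ρ₂) xs
  xs⊆ρ' = All.tabulate λ {y} y∈xs → drop-x y∈xs (∈-resp-↭ ρ↭ (All.lookup xs⊆ρ y∈xs))
    where
    drop-x : ∀ {y} → y ∈ xs → y ∈ x ∷ ρ₁ ++ ρ₂ → y ∈ ρ₁ ++ ρ₂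
    drop-x y∈xs (here refl) = ⊥-elim (k∉xs (∈-map⁺ proj₁ y∈xs))
    drop-x _ (there y∈ρ') = y∈ρ'

-- Translation of types

cdual-involutive : ∀ A → cdual (cdual A) ≡ A
cdual-involutive (A ⊗ B) = cong₂ _⊗_ (cdual-involutive A) (cdual-involutive B)
cdual-involutive (A ⅋ B) = cong₂ _⅋_ (cdual-involutive A) (cdual-involutive B)
cdual-involutive (A ⊕ B) = cong₂ _⊕_ (cdual-involutive A) (cdual-involutive B)
cdual-involutive (A & B) = cong₂ _&_ (cdual-involutive A) (cdual-involutive B)
cdual-involutive Zer = refl
cdual-involutive Top = refl
cdual-involutive One = refl
cdual-involutive Bot = refl
cdual-involutive (?' A) = cong ?' (cdual-involutive A)
cdual-involutive (!' A) = cong !' (cdual-involutive A)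
cdual-involutive (∃' X A) = cong (∃' X) (cdual-involutive A)
cdual-involutive (∀' X A) = cong (∀' X) (cdual-involutive A)
cdual-involutive (tv X) = refl
cdual-involutive (tv⊥ X) = refl

⟦⟧-dual : ∀ A → ⟦ dual A ⟧ ≡ cdual ⟦ A ⟧
⟦⟧-dual (A ⊗ B) = cong₂ _⅋_ (⟦⟧-dual A) (⟦⟧-dual B)
⟦⟧-dual (A ⅋ B) = cong₂ _⊗_ (⟦⟧-dual A) (⟦⟧-dual B)
⟦⟧-dual (A ⊕ B) = cong₂ _&_ (⟦⟧-dual A) (⟦⟧-dual B)
⟦⟧-dual (A & B) = cong₂ _⊕_ (⟦⟧-dual A) (⟦⟧-dual B)
⟦⟧-dual Zer = refl
⟦⟧-dual Top = refl
⟦⟧-dual One = refl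
⟦⟧-dual Bot = refl
⟦⟧-dual (?' A) = cong !' (⟦⟧-dual A)
⟦⟧-dual (!' A) = cong ?' (⟦⟧-dual A)
⟦⟧-dual (∃' X A) = cong (∀' X) (⟦⟧-dual A)
⟦⟧-dual (∀' X A) = cong (∃' X) (⟦⟧-dual A)
⟦⟧-dual (tv X) = refl
⟦⟧-dual (tv⊥ X) = refl
⟦⟧-dual (send Δ) = cong (_⅋ Bot) (sym (cdual-involutive (⟦ Δ ⟧Δ)))
⟦⟧-dual (recv Δ) = refl

ctsub-cdual : ∀ B A X → ctsub (cdual B) A X ≡ cdual (ctsub B A X)
ctsub-cdual (B ⊗ C) A X = cong₂ _⅋_ (ctsub-cdual B A X) (ctsub-cdual C A X)
ctsub-cdual (B ⅋ C) A X = cong₂ _⊗_ (ctsub-cdual B A X) (ctsub-cdual C A X)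
ctsub-cdual (B ⊕ C) A X = cong₂ _&_ (ctsub-cdual B A X) (ctsub-cdual C A X)
ctsub-cdual (B & C) A X = cong₂ _⊕_ (ctsub-cdual B A X) (ctsub-cdual C A X)
ctsub-cdual Zer A X = refl
ctsub-cdual Top A X = refl
ctsub-cdual One A X = refl
ctsub-cdual Bot A X = refl
ctsub-cdual (?' B) A X = cong !' (ctsub-cdual B A X)
ctsub-cdual (!' B) A X = cong ?' (ctsub-cdual B A X)
ctsub-cdual (∃' Y B) A X with X ≟ℕ Y
... | yes _ = refl
... | no _ = cong (∀' Y) (ctsub-cdual B A X)
ctsub-cdual (∀' Y B) A X with X ≟ℕ Y
... | yes _ = refl
... | no _ = cong (∃' Y) (ctsub-cdual B A X)
ctsub-cdual (tv Y) A X with X ≟ℕ Y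
... | yes _ = refl
... | no _ = refl
ctsub-cdual (tv⊥ Y) A X with X ≟ℕ Y
... | yes _ = sym (cdual-involutive A)
... | no _ = refl

⨂-duals : List (Label × CTy) → CTy
⨂-duals = foldr (λ lB acc → cdual (proj₂ lB) ⊗ acc) One

ctsub-⨂-duals : ∀ L A X → ctsub (⨂-duals L) A X ≡ ⨂-duals (map (map₂ λ B → ctsub B A X) L)
ctsub-⨂-duals [] A X = refl
ctsub-⨂-duals ((l , B) ∷ L) A X = cong₂ _⊗_ (ctsub-cdual B A X) (ctsub-⨂-duals L A X)

ctsub-lctx : ∀ L A X → ctsub (lctx L) A X ≡ lctx (map (map₂ λ B → ctsub B A X) L)
ctsub-lctx L A X =
  ≡-trans (ctsub-⨂-duals (sortK L) A X) (cong ⨂-duals (sym (sortK-map₂ (λ B → ctsub B A X) L)))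

mutual
  ⟦⟧-tsub : ∀ B A X → ⟦ tsub B A X ⟧ ≡ ctsub ⟦ B ⟧ ⟦ A ⟧ X
  ⟦⟧-tsub (B ⊗ C) A X = cong₂ _⊗_ (⟦⟧-tsub B A X) (⟦⟧-tsub C A X)
  ⟦⟧-tsub (B ⅋ C) A X = cong₂ _⅋_ (⟦⟧-tsub B A X) (⟦⟧-tsub C A X)
  ⟦⟧-tsub (B ⊕ C) A X = cong₂ _⊕_ (⟦⟧-tsub B A X) (⟦⟧-tsub C A X)
  ⟦⟧-tsub (B & C) A X = cong₂ _&_ (⟦⟧-tsub B A X) (⟦⟧-tsub C A X)
  ⟦⟧-tsub Zer A X = refl
  ⟦⟧-tsub Top A X = refl
  ⟦⟧-tsub One A X = refl
  ⟦⟧-tsub Bot A X = refl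
  ⟦⟧-tsub (?' B) A X = cong ?' (⟦⟧-tsub B A X)
  ⟦⟧-tsub (!' B) A X = cong !' (⟦⟧-tsub B A X)
  ⟦⟧-tsub (∃' Y B) A X with X ≟ℕ Y
  ... | yes _ = refl
  ... | no _ = cong (∃' Y) (⟦⟧-tsub B A X)
  ⟦⟧-tsub (∀' Y B) A X with X ≟ℕ Y
  ... | yes _ = refl
  ... | no _ = cong (∀' Y) (⟦⟧-tsub B A X)
  ⟦⟧-tsub (tv Y) A X with X ≟ℕ Y
  ... | yes _ = refl
  ... | no _ = refl
  ⟦⟧-tsub (tv⊥ Y) A X with X ≟ℕ Y
  ... | yes _ = ⟦⟧-dual A
  ... | no _ = refl
  ⟦⟧-tsub (send Δ) A X = cong (_⊗ One) (begin
    cdual ⟦ tsubL Δ A X ⟧Δ                            ≡⟨ cong (cdual ∘ lctx) (⟦⟧L-tsubL Δ A X) ⟩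
    cdual (lctx (map (map₂ λ B → ctsub B ⟦ A ⟧ X) ⟦ Δ ⟧L)) ≡⟨ cong cdual (ctsub-lctx ⟦ Δ ⟧L ⟦ A ⟧ X) ⟨
    cdual (ctsub ⟦ Δ ⟧Δ ⟦ A ⟧ X)                     ≡⟨ ctsub-cdual ⟦ Δ ⟧Δ ⟦ A ⟧ X ⟨
    ctsub (cdual ⟦ Δ ⟧Δ) ⟦ A ⟧ X                     ∎)
    where open ≡-Reasoning
  ⟦⟧-tsub (recv Δ) A X =
    cong (_⅋ Bot) (≡-trans (cong lctx (⟦⟧L-tsubL Δ A X)) (sym (ctsub-lctx ⟦ Δ ⟧L ⟦ A ⟧ X)))

  ⟦⟧L-tsubL : ∀ Δ A X → ⟦ tsubL Δ A X ⟧L ≡ map (map₂ λ B → ctsub B ⟦ A ⟧ X) ⟦ Δ ⟧L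
  ⟦⟧L-tsubL [] A X = refl
  ⟦⟧L-tsubL ((l , B) ∷ Δ) A X = cong₂ (λ B' Δ' → (l , B') ∷ Δ') (⟦⟧-tsub B A X) (⟦⟧L-tsubL Δ A X)

-- Type variables

∈-removeV⁻ : ∀ X Ys {Y} → Y ∈ removeV X Ys → Y ∈ Ys × Y ≢ X
∈-removeV⁻ X [] ()
∈-removeV⁻ X (Z ∷ Zs) Y∈ with X ≟ℕ Z
... | yes _ = let (Y∈Zs , Y≢X) = ∈-removeV⁻ X Zs Y∈ in there Y∈Zs , Y≢X
∈-removeV⁻ X (Z ∷ Zs) (here refl) | no X≢Z = here refl , X≢Z ∘ sym
∈-removeV⁻ X (Z ∷ Zs) (there Y∈) | no _ = let (Y∈Zs , Y≢X) = ∈-removeV⁻ X Zs Y∈ in there Y∈Zs , Y≢X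

∈-removeV⁺ : ∀ X Ys {Y} → Y ∈ Ys → Y ≢ X → Y ∈ removeV X Ys
∈-removeV⁺ X (Z ∷ Zs) Y∈ Y≢X with X ≟ℕ Z
∈-removeV⁺ X (Z ∷ Zs) (here refl) Y≢X | yes X≡Y = ⊥-elim (Y≢X (sym X≡Y))
∈-removeV⁺ X (Z ∷ Zs) (there Y∈) Y≢X | yes _ = ∈-removeV⁺ X Zs Y∈ Y≢X
∈-removeV⁺ X (Z ∷ Zs) (here refl) Y≢X | no _ = here refl
∈-removeV⁺ X (Z ∷ Zs) (there Y∈) Y≢X | no _ = there (∈-removeV⁺ X Zs Y∈ Y≢X)

removeV⁺ : ∀ X {Ys Zs} → Ys ⊆ Zs → removeV X Ys ⊆ removeV X Zs
removeV⁺ X {Ys} {Zs} Ys⊆Zs Y∈ = let (Y∈Ys , Y≢X) = ∈-removeV⁻ X Ys Y∈ in ∈-removeV⁺ X Zs (Ys⊆Zs Y∈Ys) Y≢X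

cftv-cdual : ∀ A → cftv (cdual A) ≡ cftv A
cftv-cdual (A ⊗ B) = cong₂ _++_ (cftv-cdual A) (cftv-cdual B)
cftv-cdual (A ⅋ B) = cong₂ _++_ (cftv-cdual A) (cftv-cdual B)
cftv-cdual (A ⊕ B) = cong₂ _++_ (cftv-cdual A) (cftv-cdual B)
cftv-cdual (A & B) = cong₂ _++_ (cftv-cdual A) (cftv-cdual B)
cftv-cdual Zer = refl
cftv-cdual Top = refl
cftv-cdual One = refl
cftv-cdual Bot = refl
cftv-cdual (?' A) = cftv-cdual A
cftv-cdual (!' A) = cftv-cdual A
cftv-cdual (∃' X A) = cong (removeV X) (cftv-cdual A)
cftv-cdual (∀' X A) = cong (removeV X) (cftv-cdual A)
cftv-cdual (tv X) = refl
cftv-cdual (tv⊥ X) = refl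

cbtv-cdual : ∀ A → cbtv (cdual A) ≡ cbtv A
cbtv-cdual (A ⊗ B) = cong₂ _++_ (cbtv-cdual A) (cbtv-cdual B)
cbtv-cdual (A ⅋ B) = cong₂ _++_ (cbtv-cdual A) (cbtv-cdual B)
cbtv-cdual (A ⊕ B) = cong₂ _++_ (cbtv-cdual A) (cbtv-cdual B)
cbtv-cdual (A & B) = cong₂ _++_ (cbtv-cdual A) (cbtv-cdual B)
cbtv-cdual Zer = refl
cbtv-cdual Top = refl
cbtv-cdual One = refl
cbtv-cdual Bot = refl
cbtv-cdual (?' A) = cbtv-cdual A
cbtv-cdual (!' A) = cbtv-cdual A
cbtv-cdual (∃' X A) = cong (X ∷_) (cbtv-cdual A)
cbtv-cdual (∀' X A) = cong (X ∷_) (cbtv-cdual A)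
cbtv-cdual (tv X) = refl
cbtv-cdual (tv⊥ X) = refl

module _ (V : CTy → List TVar) (V-cdual : ∀ A → V (cdual A) ≡ V A)
         (V-⊗ : ∀ A B → V (A ⊗ B) ≡ V A ++ V B) (V-One : V One ≡ []) where

  ∈-⨂-duals⁻ : ∀ L {Y} → Y ∈ V (⨂-duals L) → Any (λ lB → Y ∈ V (proj₂ lB)) L
  ∈-⨂-duals⁻ [] Y∈ rewrite V-One with Y∈
  ... | ()
  ∈-⨂-duals⁻ ((l , B) ∷ L) Y∈ rewrite V-⊗ (cdual B) (⨂-duals L) with ∈-++⁻ (V (cdual B)) Y∈
  ... | inj₁ Y∈B = here (subst (_ ∈_) (V-cdual B) Y∈B)
  ... | inj₂ Y∈L = there (∈-⨂-duals⁻ L Y∈L)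

  ∈-lctx⁻ : ∀ L {Y} → Y ∈ V (lctx L) → Any (λ lB → Y ∈ V (proj₂ lB)) L
  ∈-lctx⁻ L Y∈ = Any-resp-↭ (sortK-↭ L) (∈-⨂-duals⁻ (sortK L) Y∈)

mutual
  ⟦⟧-ftv : ∀ A → cftv ⟦ A ⟧ ⊆ ftv A
  ⟦⟧-ftv (A ⊗ B) = ⊆-++⁺ (⟦⟧-ftv A) (⟦⟧-ftv B)
  ⟦⟧-ftv (A ⅋ B) = ⊆-++⁺ (⟦⟧-ftv A) (⟦⟧-ftv B)
  ⟦⟧-ftv (A ⊕ B) = ⊆-++⁺ (⟦⟧-ftv A) (⟦⟧-ftv B)
  ⟦⟧-ftv (A & B) = ⊆-++⁺ (⟦⟧-ftv A) (⟦⟧-ftv B)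
  ⟦⟧-ftv (?' A) = ⟦⟧-ftv A
  ⟦⟧-ftv (!' A) = ⟦⟧-ftv A
  ⟦⟧-ftv (∃' X A) = removeV⁺ X (⟦⟧-ftv A)
  ⟦⟧-ftv (∀' X A) = removeV⁺ X (⟦⟧-ftv A)
  ⟦⟧-ftv (tv X) Y∈ = Y∈
  ⟦⟧-ftv (tv⊥ X) Y∈ = Y∈
  ⟦⟧-ftv (send Δ) Y∈ with ∈-++⁻ (cftv (cdual ⟦ Δ ⟧Δ)) Y∈
  ... | inj₁ Y∈Δ = ⟦⟧Δ-ftv Δ (subst (_ ∈_) (cftv-cdual ⟦ Δ ⟧Δ) Y∈Δ)
  ⟦⟧-ftv (recv Δ) Y∈ with ∈-++⁻ (cftv ⟦ Δ ⟧Δ) Y∈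
  ... | inj₁ Y∈Δ = ⟦⟧Δ-ftv Δ Y∈Δ

  ⟦⟧Δ-ftv : ∀ Δ → cftv ⟦ Δ ⟧Δ ⊆ ftvL Δ
  ⟦⟧Δ-ftv Δ Y∈ = ⟦⟧L-ftv Δ (∈-lctx⁻ cftv cftv-cdual (λ _ _ → refl) refl ⟦ Δ ⟧L Y∈)

  ⟦⟧L-ftv : ∀ Δ {Y} → Any (λ lB → Y ∈ cftv (proj₂ lB)) ⟦ Δ ⟧L → Y ∈ ftvL Δ
  ⟦⟧L-ftv ((l , A) ∷ Δ) (here Y∈A) = ∈-++⁺ˡ (⟦⟧-ftv A Y∈A)
  ⟦⟧L-ftv ((l , A) ∷ Δ) (there Y∈Δ) = ∈-++⁺ʳ (ftv A) (⟦⟧L-ftv Δ Y∈Δ)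

mutual
  ⟦⟧-btv : ∀ A → cbtv ⟦ A ⟧ ⊆ btv A
  ⟦⟧-btv (A ⊗ B) = ⊆-++⁺ (⟦⟧-btv A) (⟦⟧-btv B)
  ⟦⟧-btv (A ⅋ B) = ⊆-++⁺ (⟦⟧-btv A) (⟦⟧-btv B)
  ⟦⟧-btv (A ⊕ B) = ⊆-++⁺ (⟦⟧-btv A) (⟦⟧-btv B)
  ⟦⟧-btv (A & B) = ⊆-++⁺ (⟦⟧-btv A) (⟦⟧-btv B)
  ⟦⟧-btv (?' A) = ⟦⟧-btv A
  ⟦⟧-btv (!' A) = ⟦⟧-btv A
  ⟦⟧-btv (∃' X A) (here X≡) = here X≡
  ⟦⟧-btv (∃' X A) (there Y∈) = there (⟦⟧-btv A Y∈)
  ⟦⟧-btv (∀' X A) (here X≡) = here X≡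
  ⟦⟧-btv (∀' X A) (there Y∈) = there (⟦⟧-btv A Y∈)
  ⟦⟧-btv (send Δ) Y∈ with ∈-++⁻ (cbtv (cdual ⟦ Δ ⟧Δ)) Y∈
  ... | inj₁ Y∈Δ = ⟦⟧Δ-btv Δ (subst (_ ∈_) (cbtv-cdual ⟦ Δ ⟧Δ) Y∈Δ)
  ⟦⟧-btv (recv Δ) Y∈ with ∈-++⁻ (cbtv ⟦ Δ ⟧Δ) Y∈
  ... | inj₁ Y∈Δ = ⟦⟧Δ-btv Δ Y∈Δ

  ⟦⟧Δ-btv : ∀ Δ → cbtv ⟦ Δ ⟧Δ ⊆ btvL Δ
  ⟦⟧Δ-btv Δ Y∈ = ⟦⟧L-btv Δ (∈-lctx⁻ cbtv cbtv-cdual (λ _ _ → refl) refl ⟦ Δ ⟧L Y∈)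

  ⟦⟧L-btv : ∀ Δ {Y} → Any (λ lB → Y ∈ cbtv (proj₂ lB)) ⟦ Δ ⟧L → Y ∈ btvL Δ
  ⟦⟧L-btv ((l , A) ∷ Δ) (here Y∈A) = ∈-++⁺ˡ (⟦⟧-btv A Y∈A)
  ⟦⟧L-btv ((l , A) ∷ Δ) (there Y∈Δ) = ∈-++⁺ʳ (btv A) (⟦⟧L-btv Δ Y∈Δ)

-- Translated contexts

⟦_⟧E : Env → CCtxCP
⟦_⟧E = map λ pΔ → xᵖ (proj₁ pΔ) , ⟦ proj₂ pΔ ⟧Δ

⟦⟧C-map : ∀ Γ → ⟦ Γ ⟧C ≡ map (λ xA → ch (proj₁ xA) , ⟦ proj₂ xA ⟧) Γ
⟦⟧C-map [] = refl
⟦⟧C-map (_ ∷ Γ) = cong (_ ∷_) (⟦⟧C-map Γ)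

⟦⟧C-++ : ∀ Γ Δ → ⟦ Γ ++ Δ ⟧C ≡ ⟦ Γ ⟧C ++ ⟦ Δ ⟧C
⟦⟧C-++ [] Δ = refl
⟦⟧C-++ (_ ∷ Γ) Δ = cong (_ ∷_) (⟦⟧C-++ Γ Δ)

⟦⟧C-↭ : ∀ {Γ Γ'} → Γ ↭ Γ' → ⟦ Γ ⟧C ↭ ⟦ Γ' ⟧C
⟦⟧C-↭ {Γ} {Γ'} p = subst₂ _↭_ (sym (⟦⟧C-map Γ)) (sym (⟦⟧C-map Γ')) (map⁺ _ p)

ckeys-⟦⟧C : ∀ Γ → ckeys ⟦ Γ ⟧C ≡ map ch (keys Γ)
ckeys-⟦⟧C [] = refl
ckeys-⟦⟧C (_ ∷ Γ) = cong (_ ∷_) (ckeys-⟦⟧C Γ)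

ckeys-⟦⟧E : ∀ Θ → ckeys ⟦ Θ ⟧E ≡ map xᵖ (keys Θ)
ckeys-⟦⟧E [] = refl
ckeys-⟦⟧E (_ ∷ Θ) = cong (_ ∷_) (ckeys-⟦⟧E Θ)

ckeys-⟦⟧ : ∀ Γ Θ → ckeys (⟦ Γ ⟧C ++ ⟦ Θ ⟧E) ≡ map ch (keys Γ) ++ map xᵖ (keys Θ)
ckeys-⟦⟧ Γ Θ = ≡-trans (map-++ proj₁ ⟦ Γ ⟧C ⟦ Θ ⟧E) (cong₂ _++_ (ckeys-⟦⟧C Γ) (ckeys-⟦⟧E Θ))

CDistinct-resp-↭ : ∀ {Γ Δ : CCtxCP} → Γ ↭ Δ → CDistinct Γ → CDistinct Δ
CDistinct-resp-↭ p = Unique-resp-↭ (map⁺ proj₁ p)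

ch-injective : ∀ {a b} → ch a ≡ ch b → a ≡ b
ch-injective refl = refl

xᵖ-injective : ∀ {p q} → xᵖ p ≡ xᵖ q → p ≡ q
xᵖ-injective refl = refl

⟦⟧-distinct : ∀ Γ Θ → Distinct Γ → Unique (keys Θ) → CDistinct (⟦ Γ ⟧C ++ ⟦ Θ ⟧E)
⟦⟧-distinct Γ Θ dΓ uΘ rewrite ckeys-⟦⟧ Γ Θ =
  Unique.++⁺ (Unique.map⁺ ch-injective dΓ) (Unique.map⁺ xᵖ-injective uΘ) ch≢xᵖ
  where
  ch≢xᵖ : ∀ {n} → ¬ (n ∈ map ch (keys Γ) × n ∈ map xᵖ (keys Θ))
  ch≢xᵖ (n∈ch , n∈xᵖ) with ∈-map⁻ ch n∈ch | ∈-map⁻ xᵖ n∈xᵖ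
  ... | _ , _ , refl | _ , _ , ()

ch∉⟦⟧ : ∀ {x} Γ Θ → x ∉ keys Γ → ch x ∉ ckeys (⟦ Γ ⟧C ++ ⟦ Θ ⟧E)
ch∉⟦⟧ Γ Θ x∉Γ x∈ rewrite ckeys-⟦⟧ Γ Θ with ∈-++⁻ (map ch (keys Γ)) x∈
... | inj₁ x∈Γ with ∈-map⁻ ch x∈Γ
...   | _ , x∈Γ' , refl = x∉Γ x∈Γ'
ch∉⟦⟧ Γ Θ x∉Γ x∈ | inj₂ x∈Θ with ∈-map⁻ xᵖ x∈Θ
...   | _ , _ , ()

∉⟦⟧E : ∀ {n} Θ → (∀ p → n ≢ xᵖ p) → n ∉ ckeys ⟦ Θ ⟧E
∉⟦⟧E Θ n≢xᵖ n∈ rewrite ckeys-⟦⟧E Θ with ∈-map⁻ xᵖ n∈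
... | p , _ , n≡xᵖ = n≢xᵖ p n≡xᵖ

cftvL-++ : ∀ (Γ Δ : CCtxCP) → cftvL (Γ ++ Δ) ≡ cftvL Γ ++ cftvL Δ
cftvL-++ [] Δ = refl
cftvL-++ ((_ , A) ∷ Γ) Δ = ≡-trans (cong (cftv A ++_) (cftvL-++ Γ Δ)) (sym (++-assoc (cftv A) (cftvL Γ) (cftvL Δ)))

⟦⟧C-ftv : ∀ Γ → cftvL ⟦ Γ ⟧C ⊆ ftvL Γ
⟦⟧C-ftv ((_ , A) ∷ Γ) = ⊆-++⁺ (⟦⟧-ftv A) (⟦⟧C-ftv Γ)

⟦⟧E-ftv : ∀ Θ → cftvL ⟦ Θ ⟧E ⊆ ftvE Θ
⟦⟧E-ftv ((_ , Δ) ∷ Θ) = ⊆-++⁺ (⟦⟧Δ-ftv Δ) (⟦⟧E-ftv Θ)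

∉cftv⟦⟧ : ∀ {X} Γ Θ → X ∉ ftvL Γ → X ∉ ftvE Θ → X ∉ cftvL (⟦ Γ ⟧C ++ ⟦ Θ ⟧E)
∉cftv⟦⟧ Γ Θ X∉Γ X∉Θ X∈ rewrite cftvL-++ ⟦ Γ ⟧C ⟦ Θ ⟧E with ∈-++⁻ (cftvL ⟦ Γ ⟧C) X∈
... | inj₁ X∈Γ = X∉Γ (⟦⟧C-ftv Γ X∈Γ)
... | inj₂ X∈Θ = X∉Θ (⟦⟧E-ftv Θ X∈Θ)

⟦⟧C-whyNot : ∀ Γ → All (IsWhyNot ∘ proj₂) Γ → All (CIsWhyNot ∘ proj₂) ⟦ Γ ⟧C
⟦⟧C-whyNot [] [] = []
⟦⟧C-whyNot ((_ , ?' _) ∷ Γ) (_ ∷ w) = tt ∷ ⟦⟧C-whyNot Γ w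

-- Invariants of CHOP derivations

WfL⇒Distinct : ∀ Γ → WfL Γ → Distinct Γ
WfL⇒Distinct [] _ = []
WfL⇒Distinct (_ ∷ Γ) (x∉Γ , _ , wf) = ¬Any⇒All¬ _ x∉Γ ∷ WfL⇒Distinct Γ wf

WfE⇒Unique : ∀ Θ → WfE Θ → Unique (keys Θ)
WfE⇒Unique [] _ = []
WfE⇒Unique (_ ∷ Θ) (p∉Θ , _ , wf) = ¬Any⇒All¬ _ p∉Θ ∷ WfE⇒Unique Θ wf

⊢-distinct : ∀ {Θ P Γ} → Θ ⊢ P ⦂ Γ → Distinct Γ
⊢-distinct (Tax x≢y _) = (x≢y ∷ []) ∷ [] ∷ []
⊢-distinct (Tcut _ _ _ dist _) = dist
⊢-distinct (T⊗ _ _ _ dist) = dist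
⊢-distinct (T⅋ d) with ⊢-distinct d
... | _ ∷ dist = dist
⊢-distinct (T⊕₁ _ d) = ⊢-distinct d
⊢-distinct (T⊕₂ _ d) = ⊢-distinct d
⊢-distinct (T& d _) = ⊢-distinct d
⊢-distinct (T? d x∉) with ⊢-distinct d
... | _ ∷ dist = ¬Any⇒All¬ _ x∉ ∷ dist
⊢-distinct (T! d _ x∉) with ⊢-distinct d
... | _ ∷ dist = ¬Any⇒All¬ _ x∉ ∷ dist
⊢-distinct (T∃ _ _ d) with ⊢-distinct d
... | x∉ ∷ dist = x∉ ∷ dist
⊢-distinct (T∀ d _ _) with ⊢-distinct d
... | x∉ ∷ dist = x∉ ∷ dist
⊢-distinct (Tweak _ d x∉) = ¬Any⇒All¬ _ x∉ ∷ ⊢-distinct d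
⊢-distinct (Tcon d x∉ _) with ⊢-distinct d
... | _ ∷ _ ∷ dist = ¬Any⇒All¬ _ x∉ ∷ dist
⊢-distinct T𝟏 = [] ∷ []
⊢-distinct (T⊥ d x∉) = ¬Any⇒All¬ _ x∉ ∷ ⊢-distinct d
⊢-distinct (T⊤ {Γ = Γ} {x} _ wf) = WfL⇒Distinct ((x , Top) ∷ Γ) wf
⊢-distinct (Tid _ _ _ dist) = dist
⊢-distinct (Tchop _ _ _ d _) = ⊢-distinct d
⊢-distinct (Tsend _ _ _) = [] ∷ []
⊢-distinct (Trecv d x∉) = ¬Any⇒All¬ _ x∉ ∷ ⊢-distinct d
⊢-distinct (Texch _ Γ↭ d) = Unique-resp-↭ (keys-↭ Γ↭) (⊢-distinct d)

⊢-uniqueEnv : ∀ {Θ P Γ} → Θ ⊢ P ⦂ Γ → Unique (keys Θ)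
⊢-uniqueEnv (Tax _ _) = []
⊢-uniqueEnv (Tcut _ _ wf _ _) = WfE⇒Unique _ wf
⊢-uniqueEnv (T⊗ _ _ wf _) = WfE⇒Unique _ wf
⊢-uniqueEnv (T⅋ d) = ⊢-uniqueEnv d
⊢-uniqueEnv (T⊕₁ _ d) = ⊢-uniqueEnv d
⊢-uniqueEnv (T⊕₂ _ d) = ⊢-uniqueEnv d
⊢-uniqueEnv (T& d _) = ⊢-uniqueEnv d
⊢-uniqueEnv (T? d _) = ⊢-uniqueEnv d
⊢-uniqueEnv (T! _ _ _) = []
⊢-uniqueEnv (T∃ _ _ d) = ⊢-uniqueEnv d
⊢-uniqueEnv (T∀ d _ _) = ⊢-uniqueEnv d
⊢-uniqueEnv (Tweak _ d _) = ⊢-uniqueEnv d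
⊢-uniqueEnv (Tcon d _ _) = ⊢-uniqueEnv d
⊢-uniqueEnv T𝟏 = []
⊢-uniqueEnv (T⊥ d _) = ⊢-uniqueEnv d
⊢-uniqueEnv (T⊤ wf _) = WfE⇒Unique _ wf
⊢-uniqueEnv (Tid _ _ _ _) = [] ∷ []
⊢-uniqueEnv (Tchop _ _ _ _ wf) = WfE⇒Unique _ wf
⊢-uniqueEnv (Tsend _ _ d) = ⊢-uniqueEnv d
⊢-uniqueEnv (Trecv d _) with ⊢-uniqueEnv d
... | _ ∷ u = u
⊢-uniqueEnv (Texch Θ↭ _ d) = Unique-resp-↭ (keys-↭ Θ↭) (⊢-uniqueEnv d)

-- Bound channel names

cbn-cren : ∀ f P → cbn (cren f P) ≡ cbn P
cbn-cren f (out x y P Q) = cong (y ∷_) (cong₂ _++_ (cbn-cren _ P) (cbn-cren f Q))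
cbn-cren f (inp x y P) = cong (y ∷_) (cbn-cren _ P)
cbn-cren f (inl x P) = cbn-cren f P
cbn-cren f (inr x P) = cbn-cren f P
cbn-cren f (case x P Q) = cong₂ _++_ (cbn-cren f P) (cbn-cren f Q)
cbn-cren f (whyNot x y P) = cong (y ∷_) (cbn-cren _ P)
cbn-cren f (bang x y P) = cong (y ∷_) (cbn-cren _ P)
cbn-cren f (tout x A P) = cbn-cren f P
cbn-cren f (tin x X P) = cbn-cren f P
cbn-cren f (close x) = refl
cbn-cren f (wait x P) = cbn-cren f P
cbn-cren f (caseEmpty x) = refl
cbn-cren f (fwd x A y) = refl
cbn-cren f (nu x A y P Q) = cong (λ ns → x ∷ y ∷ ns) (cong₂ _++_ (cbn-cren _ P) (cbn-cren _ Q))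

bn-ren : ∀ f P → bn (ren f P) ≡ bn P
bn-ren f (out x y P Q) = cong (y ∷_) (cong₂ _++_ (bn-ren _ P) (bn-ren f Q))
bn-ren f (inp x y P) = cong (y ∷_) (bn-ren _ P)
bn-ren f (inl x P) = bn-ren f P
bn-ren f (inr x P) = bn-ren f P
bn-ren f (case x P Q) = cong₂ _++_ (bn-ren f P) (bn-ren f Q)
bn-ren f (whyNot x y P) = cong (y ∷_) (bn-ren _ P)
bn-ren f (bang x y P) = cong (y ∷_) (bn-ren _ P)
bn-ren f (tout x A P) = bn-ren f P
bn-ren f (tin x X P) = bn-ren f P
bn-ren f (sendAbs x ρ P) = cong (image ρ ++_) (bn-ren _ P)
bn-ren f (recvAbs x p P) = bn-ren f P
bn-ren f (run p ρ) = refl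
bn-ren f (close x) = refl
bn-ren f (wait x P) = bn-ren f P
bn-ren f (caseEmpty x) = refl
bn-ren f (fwd x A y) = refl
bn-ren f (nu x A y P Q) = cong (λ cs → x ∷ y ∷ cs) (cong₂ _++_ (bn-ren _ P) (bn-ren _ Q))
bn-ren f (letP p ρ P Q) = cong (image ρ ++_) (cong₂ _++_ (bn-ren _ P) (bn-ren f Q))

infix 4 _⊆ᶜʰ_

_⊆ᶜʰ_ : List Name → List Ch → Set
ns ⊆ᶜʰ cs = ∀ {c} → ch c ∈ ns → c ∈ cs

⊆ᶜʰ-++⁺ : ∀ {ns ns' cs cs'} → ns ⊆ᶜʰ cs → ns' ⊆ᶜʰ cs' → ns ++ ns' ⊆ᶜʰ cs ++ cs'
⊆ᶜʰ-++⁺ {ns} {cs = cs} ns⊆ ns'⊆ c∈ with ∈-++⁻ ns c∈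
... | inj₁ c∈ns = ∈-++⁺ˡ (ns⊆ c∈ns)
... | inj₂ c∈ns' = ∈-++⁺ʳ cs (ns'⊆ c∈ns')

cbn-inputs : ∀ y σ P {cs} → cbn P ⊆ᶜʰ cs → cbn (inputs y σ P) ⊆ᶜʰ image σ ++ cs
cbn-inputs y [] P P⊆ = P⊆
cbn-inputs y ((_ , z) ∷ σ) P P⊆ (here c≡z) = here (ch-injective c≡z)
cbn-inputs y ((_ , z) ∷ σ) P P⊆ (there c∈) = there (cbn-inputs y σ P P⊆ c∈)

cbn-outputs : ∀ p σ τ → cbn (outputs p σ τ) ⊆ᶜʰ []
cbn-outputs p ((_ , z) ∷ σ) ((_ , B) ∷ τ) (there c∈) = cbn-outputs p σ τ c∈

image-sortK : ∀ ρ → image (sortK ρ) ⊆ image ρ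
image-sortK ρ = ∈-resp-↭ (map⁺ proj₂ (sortK-↭ ρ))

cbn-tr : ∀ {Θ P Γ} (d : Θ ⊢ P ⦂ Γ) → cbn (tr d) ⊆ᶜʰ bn P
cbn-tr (Tcut d e _ _ _) (here x≡) = here (ch-injective x≡)
cbn-tr (Tcut d e _ _ _) (there (here y≡)) = there (here (ch-injective y≡))
cbn-tr (Tcut d e _ _ _) (there (there c∈)) = there (there (⊆ᶜʰ-++⁺ (cbn-tr d) (cbn-tr e) c∈))
cbn-tr (T⊗ d e _ _) (here y≡) = here (ch-injective y≡)
cbn-tr (T⊗ d e _ _) (there c∈) = there (⊆ᶜʰ-++⁺ (cbn-tr d) (cbn-tr e) c∈)
cbn-tr (T⅋ d) (here y≡) = here (ch-injective y≡)
cbn-tr (T⅋ d) (there c∈) = there (cbn-tr d c∈)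
cbn-tr (T⊕₁ _ d) = cbn-tr d
cbn-tr (T⊕₂ _ d) = cbn-tr d
cbn-tr (T& d e) = ⊆ᶜʰ-++⁺ (cbn-tr d) (cbn-tr e)
cbn-tr (T? d _) (here y≡) = here (ch-injective y≡)
cbn-tr (T? d _) (there c∈) = there (cbn-tr d c∈)
cbn-tr (T! d _ _) (here y≡) = here (ch-injective y≡)
cbn-tr (T! d _ _) (there c∈) = there (cbn-tr d c∈)
cbn-tr (T∃ _ _ d) = cbn-tr d
cbn-tr (T∀ d _ _) = cbn-tr d
cbn-tr (Tweak _ d _) = cbn-tr d
cbn-tr (Tcon {P = P} {x = x} {y} {z} d _ _) c∈ =
  subst (_ ∈_) (sym (bn-ren (sub2 x y z) P))
    (cbn-tr d (subst (_ ∈_) (cbn-cren (csub2 (ch x) (ch y) (ch z)) (tr d)) c∈))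
cbn-tr (T⊥ d _) = cbn-tr d
cbn-tr (Tid {p} {ρ} {Γ} _ _ _ _) c∈ with cbn-outputs p (sortK ρ) (sortK ⟦ Γ ⟧L) c∈
... | ()
cbn-tr (Tchop {P = P} {Q} {p = p} {ρ} _ _ d e _) (there (there c∈)) with ∈-++⁻ (cbn (tr e)) c∈
... | inj₁ c∈Q = ∈-++⁺ʳ (image ρ) (∈-++⁺ʳ (bn P) (cbn-tr e c∈Q))
... | inj₂ c∈P = ⊆-++⁺ (image-sortK ρ) (xs⊆xs++ys (bn P) (bn Q))
                   (cbn-inputs (yᵖ p) (sortK ρ) (tr d) (cbn-tr d) c∈P)
cbn-tr (Tsend {ρ = ρ} _ _ d) (there c∈) with ∈-++⁻ (cbn (inputs fresh (sortK ρ) (tr d))) c∈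
... | inj₁ c∈P = ⊆-++⁺ (image-sortK ρ) (λ c∈ → c∈) (cbn-inputs fresh (sortK ρ) (tr d) (cbn-tr d) c∈P)
cbn-tr (Trecv d _) (there c∈) = cbn-tr d c∈
cbn-tr (Texch _ _ d) = cbn-tr d

-- Chains of inputs and outputs along a record

Aligned : Set
Aligned = List (Label × Ch × CTy)

recordOf : Aligned → Record
recordOf = map (map₂ proj₁)

typesOf : Aligned → List (Label × CTy)
typesOf = map (map₂ proj₂)

contextOf : Aligned → CCtxCP
contextOf = map λ lzB → ch (proj₁ (proj₂ lzB)) , proj₂ (proj₂ lzB)

xᵖ∉contextOf : ∀ p K → All (xᵖ p ≢_) (ckeys (contextOf K))
xᵖ∉contextOf p [] = []
xᵖ∉contextOf p (_ ∷ K) = (λ ()) ∷ xᵖ∉contextOf p K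

⊢inputs : ∀ {y P E} K → (∀ c → y ≢ ch c) → y ∉ ckeys E → ⊢ᶜ P ⦂ contextOf K ++ E →
  ⊢ᶜ inputs y (recordOf K) P ⦂ (y , cdual (⨂-duals (typesOf K))) ∷ E
⊢inputs [] _ y∉E ⊢P = C⊥ ⊢P y∉E
⊢inputs {y} {P} {E} ((l , z , B) ∷ K) y≢ch y∉E ⊢P =
  C⅋ (subst (λ B' → ⊢ᶜ _ ⦂ (ch z , B') ∷ _) (sym (cdual-involutive B)) (Cexch (swap _ _ refl) ⊢rest))
  where
  y∉zE : y ∉ ckeys ((ch z , B) ∷ E)
  y∉zE (here y≡z) = y≢ch z y≡z
  y∉zE (there y∈E) = y∉E y∈E
  ⊢rest : ⊢ᶜ inputs y (recordOf K) P ⦂ (y , cdual (⨂-duals (typesOf K))) ∷ (ch z , B) ∷ E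
  ⊢rest = ⊢inputs K y≢ch y∉zE (Cexch (↭-sym (shift (ch z , B) (contextOf K) E)) ⊢P)

⊢outputs : ∀ p K → CDistinct (contextOf K) →
  ⊢ᶜ outputs p (recordOf K) (typesOf K) ⦂ (xᵖ p , ⨂-duals (typesOf K)) ∷ contextOf K
⊢outputs p [] _ = C𝟏
⊢outputs p K@((l , z , B) ∷ K') (z∉K' ∷ distinct) = C⊗ ⊢fwd (⊢outputs p K' distinct) (xᵖ∉contextOf p K ∷ z∉K' ∷ distinct)
  where
  ⊢fwd : ⊢ᶜ fwd (ch z) (cdual B) fresh ⦂ (fresh , cdual B) ∷ (ch z , B) ∷ []
  ⊢fwd = Cexch (swap _ _ refl)
    (subst (λ B' → ⊢ᶜ fwd (ch z) (cdual B) fresh ⦂ (ch z , B') ∷ (fresh , cdual B) ∷ [])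
      (cdual-involutive B) (Cax λ ()))

record Alignment (ρ : Record) (Δ : LCtx) (Δρ : CCtx) : Set where
  field
    entries : Aligned
    record-sorted : sortK ρ ≡ recordOf entries
    types-sorted : sortK ⟦ Δ ⟧L ≡ typesOf entries
    context↭ : ⟦ Δρ ⟧C ↭ contextOf entries

module _ {ρ : Record} where

  renEntries : ∀ {Δ Δρ} → Ren ρ Δ Δρ → Aligned
  renEntries [] = []
  renEntries (_∷_ {l} {z} {A} _ r) = (l , z , ⟦ A ⟧) ∷ renEntries r

  renEntries-⊆ : ∀ {Δ Δρ} (r : Ren ρ Δ Δρ) → All (_∈ ρ) (recordOf (renEntries r))
  renEntries-⊆ [] = []
  renEntries-⊆ (lz∈ρ ∷ r) = lz∈ρ ∷ renEntries-⊆ r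

  renEntries-keys : ∀ {Δ Δρ} (r : Ren ρ Δ Δρ) → keys (recordOf (renEntries r)) ≡ keys Δ
  renEntries-keys [] = refl
  renEntries-keys (_ ∷ r) = cong (_ ∷_) (renEntries-keys r)

  renEntries-types : ∀ {Δ Δρ} (r : Ren ρ Δ Δρ) → typesOf (renEntries r) ≡ ⟦ Δ ⟧L
  renEntries-types [] = refl
  renEntries-types (_ ∷ r) = cong (_ ∷_) (renEntries-types r)

  renEntries-context : ∀ {Δ Δρ} (r : Ren ρ Δ Δρ) → contextOf (renEntries r) ≡ ⟦ Δρ ⟧C
  renEntries-context [] = refl
  renEntries-context (_ ∷ r) = cong (_ ∷_) (renEntries-context r)

  align : ∀ {Δ Δρ} → RecFor ρ Δ → Ren ρ Δ Δρ → Alignment ρ Δ Δρ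
  align {Δ} {Δρ} (uρ , keys↭) r = record
    { entries = sortK J
    ; record-sorted = ≡-trans (↭⇒sortK-≡ (↭-sym J↭ρ) uρ) (sortK-map₂ proj₁ J)
    ; types-sorted = ≡-trans (cong sortK (sym (renEntries-types r))) (sortK-map₂ proj₂ J)
    ; context↭ = subst (_↭ contextOf (sortK J)) (renEntries-context r) (map⁺ _ (↭-sym (sortK-↭ J)))
    }
    where
    J = renEntries r
    J↭ρ : recordOf J ↭ ρ
    J↭ρ = ⊆-sameKeys⇒↭ (recordOf J) uρ (subst (keys ρ ↭_) (sym (renEntries-keys r)) keys↭)
            (renEntries-⊆ r)

module _ {ρ Δ Δρ} (a : Alignment ρ Δ Δρ) where
  open Alignment a

  ⊢inputs-aligned : ∀ {y P E} → (∀ c → y ≢ ch c) → y ∉ ckeys E → ⊢ᶜ P ⦂ ⟦ Δρ ⟧C ++ E →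
    ⊢ᶜ inputs y (sortK ρ) P ⦂ (y , cdual ⟦ Δ ⟧Δ) ∷ E
  ⊢inputs-aligned {y} {P} {E} y≢ch y∉E ⊢P =
    subst₂ (λ σ τ → ⊢ᶜ inputs y σ P ⦂ (y , cdual (⨂-duals τ)) ∷ E)
      (sym record-sorted) (sym types-sorted)
      (⊢inputs entries y≢ch y∉E (Cexch (++⁺ʳ E context↭) ⊢P))

  ⊢outputs-aligned : ∀ p → CDistinct ⟦ Δρ ⟧C →
    ⊢ᶜ outputs p (sortK ρ) (sortK ⟦ Δ ⟧L) ⦂ ⟦ Δρ ⟧C ++ (xᵖ p , ⟦ Δ ⟧Δ) ∷ []
  ⊢outputs-aligned p distinct =
    subst₂ (λ σ τ → ⊢ᶜ outputs p σ τ ⦂ ⟦ Δρ ⟧C ++ (xᵖ p , ⨂-duals τ) ∷ [])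
      (sym record-sorted) (sym types-sorted)
      (Cexch (trans (prep _ (↭-sym context↭)) (∷↭∷ʳ _ ⟦ Δρ ⟧C))
        (⊢outputs p entries (CDistinct-resp-↭ context↭ distinct)))

-- Preservation of typing

⟦⟧E-++ : ∀ Θ Θ' → ⟦ Θ ++ Θ' ⟧E ≡ ⟦ Θ ⟧E ++ ⟦ Θ' ⟧E
⟦⟧E-++ Θ Θ' = map-++ _ Θ Θ'

⟦⟧E-↭ : ∀ {Θ Θ'} → Θ ↭ Θ' → ⟦ Θ ⟧E ↭ ⟦ Θ' ⟧E
⟦⟧E-↭ = map⁺ _

⟦⟧-merge : ∀ Γ Δ Θ Θ' → (⟦ Γ ⟧C ++ ⟦ Θ ⟧E) ++ (⟦ Δ ⟧C ++ ⟦ Θ' ⟧E) ↭ ⟦ Γ ++ Δ ⟧C ++ ⟦ Θ ++ Θ' ⟧E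
⟦⟧-merge Γ Δ Θ Θ' rewrite ⟦⟧C-++ Γ Δ | ⟦⟧E-++ Θ Θ'
  | ++-assoc ⟦ Γ ⟧C ⟦ Θ ⟧E (⟦ Δ ⟧C ++ ⟦ Θ' ⟧E) | ++-assoc ⟦ Γ ⟧C ⟦ Δ ⟧C (⟦ Θ ⟧E ++ ⟦ Θ' ⟧E) =
  ++⁺ˡ ⟦ Γ ⟧C (shifts ⟦ Θ ⟧E ⟦ Δ ⟧C)

⊢cut : ∀ {Θ Θ' Γ Δ x y A P Q} →
  ⊢ᶜ P ⦂ ⟦ (x , A) ∷ Γ ⟧C ++ ⟦ Θ ⟧E → ⊢ᶜ Q ⦂ ⟦ (y , dual A) ∷ Δ ⟧C ++ ⟦ Θ' ⟧E →
  Distinct (Γ ++ Δ) → Unique (keys (Θ ++ Θ')) →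
  ⊢ᶜ nu (ch x) ⟦ A ⟧ (ch y) P Q ⦂ ⟦ Γ ++ Δ ⟧C ++ ⟦ Θ ++ Θ' ⟧E
⊢cut {Θ} {Θ'} {Γ} {Δ} {y = y} {A} ⊢P ⊢Q dΓΔ uΘΘ' =
  Cexch (⟦⟧-merge Γ Δ Θ Θ')
    (Ccut ⊢P (subst (λ B → ⊢ᶜ _ ⦂ (ch y , B) ∷ _) (⟦⟧-dual A) ⊢Q)
      (CDistinct-resp-↭ (↭-sym (⟦⟧-merge Γ Δ Θ Θ')) (⟦⟧-distinct (Γ ++ Δ) (Θ ++ Θ') dΓΔ uΘΘ')))

⊢tensor : ∀ {Θ Θ' Γ Δ x y A B P Q} →
  ⊢ᶜ P ⦂ ⟦ (y , A) ∷ Γ ⟧C ++ ⟦ Θ ⟧E → ⊢ᶜ Q ⦂ ⟦ (x , B) ∷ Δ ⟧C ++ ⟦ Θ' ⟧E →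
  Distinct ((x , A ⊗ B) ∷ Γ ++ Δ) → Unique (keys (Θ ++ Θ')) →
  ⊢ᶜ out (ch x) (ch y) P Q ⦂ ⟦ (x , A ⊗ B) ∷ Γ ++ Δ ⟧C ++ ⟦ Θ ++ Θ' ⟧E
⊢tensor {Θ} {Θ'} {Γ} {Δ} {x} {A = A} {B} ⊢P ⊢Q dΓΔ uΘΘ' =
  Cexch (prep xAB merge)
    (C⊗ ⊢P ⊢Q (CDistinct-resp-↭ (↭-sym (prep xAB merge))
      (⟦⟧-distinct ((x , A ⊗ B) ∷ Γ ++ Δ) (Θ ++ Θ') dΓΔ uΘΘ')))
  where
  xAB = (ch x , ⟦ A ⟧ ⊗ ⟦ B ⟧)
  merge = ⟦⟧-merge Γ Δ Θ Θ'

⊢chop : ∀ {Θ Θ' Γ Δ Δρ p ρ P Q} → Alignment ρ Δ Δρ →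
  ⊢ᶜ P ⦂ ⟦ Δρ ⟧C ++ ⟦ Θ ⟧E → ⊢ᶜ Q ⦂ ⟦ Γ ⟧C ++ ⟦ (p , Δ) ∷ Θ' ⟧E →
  Distinct Γ → Unique (keys (Θ ++ Θ')) →
  ⊢ᶜ nu (xᵖ p) ⟦ Δ ⟧Δ (yᵖ p) Q (inputs (yᵖ p) (sortK ρ) P) ⦂ ⟦ Γ ⟧C ++ ⟦ Θ ++ Θ' ⟧E
⊢chop {Θ} {Θ'} {Γ} a ⊢P ⊢Q dΓ uΘΘ' =
  Cexch swapEnvs
    (Ccut (Cexch (shift _ ⟦ Γ ⟧C ⟦ Θ' ⟧E) ⊢Q) (⊢inputs-aligned a (λ _ ()) (∉⟦⟧E Θ λ _ ()) ⊢P)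
      (CDistinct-resp-↭ (↭-sym swapEnvs) (⟦⟧-distinct Γ (Θ ++ Θ') dΓ uΘΘ')))
  where
  swapEnvs : (⟦ Γ ⟧C ++ ⟦ Θ' ⟧E) ++ ⟦ Θ ⟧E ↭ ⟦ Γ ⟧C ++ ⟦ Θ ++ Θ' ⟧E
  swapEnvs rewrite ⟦⟧E-++ Θ Θ' | ++-assoc ⟦ Γ ⟧C ⟦ Θ' ⟧E ⟦ Θ ⟧E = ++⁺ˡ ⟦ Γ ⟧C (++-comm ⟦ Θ' ⟧E ⟦ Θ ⟧E)

⊢send : ∀ {Θ Γ Γρ x ρ P} → Alignment ρ Γ Γρ →
  ⊢ᶜ P ⦂ ⟦ Γρ ⟧C ++ ⟦ Θ ⟧E → Unique (keys Θ) →
  ⊢ᶜ out (ch x) fresh (inputs fresh (sortK ρ) P) (close (ch x)) ⦂ ⟦ (x , send Γ) ∷ [] ⟧C ++ ⟦ Θ ⟧E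
⊢send {Θ} {Γ} {x = x} a ⊢P uΘ =
  subst (λ E → ⊢ᶜ _ ⦂ (ch x , ⟦ send Γ ⟧) ∷ E) (++-identityʳ ⟦ Θ ⟧E)
    (C⊗ (⊢inputs-aligned a (λ _ ()) (∉⟦⟧E Θ λ _ ()) ⊢P) C𝟏
      (subst (λ E → CDistinct ((ch x , ⟦ send Γ ⟧) ∷ E)) (sym (++-identityʳ ⟦ Θ ⟧E))
        (⟦⟧-distinct ((x , send Γ) ∷ []) Θ ([] ∷ []) uΘ)))

⊢recv : ∀ {Θ Γ Δ x p P} → ⊢ᶜ P ⦂ ⟦ Γ ⟧C ++ ⟦ (p , Δ) ∷ Θ ⟧E → x ∉ keys Γ →
  ⊢ᶜ inp (ch x) (xᵖ p) (wait (ch x) P) ⦂ ⟦ (x , recv Δ) ∷ Γ ⟧C ++ ⟦ Θ ⟧E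
⊢recv {Θ} {Γ} {Δ} {p = p} ⊢P x∉Γ =
  C⅋ (Cexch (trans (prep _ (shift _ ⟦ Γ ⟧C ⟦ Θ ⟧E)) (swap _ _ refl))
    (C⊥ ⊢P (ch∉⟦⟧ Γ ((p , Δ) ∷ Θ) x∉Γ)))

⊢tr : ∀ {Θ P Γ} (d : Θ ⊢ P ⦂ Γ) → ⊢ᶜ tr d ⦂ ⟦ Γ ⟧C ++ ⟦ Θ ⟧E
⊢tr (Tax {x} {y} {A} x≢y _) =
  subst (λ B → ⊢ᶜ fwd (ch x) ⟦ A ⟧ (ch y) ⦂ (ch x , B) ∷ (ch y , ⟦ A ⟧) ∷ []) (sym (⟦⟧-dual A))
    (Cax (x≢y ∘ ch-injective))
⊢tr (Tcut {Θ} {Θ'} {Γ = Γ} {Δ} d e wf dist _) = ⊢cut {Θ} {Θ'} {Γ} {Δ} (⊢tr d) (⊢tr e) dist (WfE⇒Unique _ wf)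
⊢tr (T⊗ {Θ} {Θ'} {Γ = Γ} {Δ} d e wf dist) = ⊢tensor {Θ} {Θ'} {Γ} {Δ} (⊢tr d) (⊢tr e) dist (WfE⇒Unique _ wf)
⊢tr (T⅋ d) = C⅋ (⊢tr d)
⊢tr (T⊕₁ _ d) = C⊕₁ (⊢tr d)
⊢tr (T⊕₂ _ d) = C⊕₂ (⊢tr d)
⊢tr (T& d e) = C& (⊢tr d) (⊢tr e)
⊢tr (T? {Θ} {Γ = Γ} d x∉) = C? (⊢tr d) (ch∉⟦⟧ Γ Θ x∉)
⊢tr (T! {Γ = Γ} d ?Γ x∉) =
  C! (⊢tr d) (subst (All _) (sym (++-identityʳ ⟦ Γ ⟧C)) (⟦⟧C-whyNot Γ ?Γ)) (ch∉⟦⟧ Γ [] x∉)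
⊢tr (T∃ {Θ} {Γ = Γ} {x} {X} {A} {B} _ noCapture d) =
  C∃ (All.tabulate λ Y∈A Y∈B → All.lookup noCapture (⟦⟧-ftv A Y∈A) (⟦⟧-btv B Y∈B))
    (subst (λ C → ⊢ᶜ tr d ⦂ (ch x , C) ∷ ⟦ Γ ⟧C ++ ⟦ Θ ⟧E) (⟦⟧-tsub B A X) (⊢tr d))
⊢tr (T∀ {Θ} {Γ = Γ} d X∉Γ X∉Θ) = C∀ (⊢tr d) (∉cftv⟦⟧ Γ Θ X∉Γ X∉Θ)
⊢tr (Tweak {Θ} {Γ = Γ} _ d x∉) = Cweak (⊢tr d) (ch∉⟦⟧ Γ Θ x∉)
⊢tr (Tcon {Θ} {Γ = Γ} d x∉ x∉bn) = Ccon (⊢tr d) (ch∉⟦⟧ Γ Θ x∉) (x∉bn ∘ cbn-tr d)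
⊢tr T𝟏 = C𝟏
⊢tr (T⊥ {Θ} {Γ = Γ} d x∉) = C⊥ (⊢tr d) (ch∉⟦⟧ Γ Θ x∉)
⊢tr (T⊤ {Θ} {Γ} {x} wfΘ wfΓ) = C⊤ (⟦⟧-distinct ((x , Top) ∷ Γ) Θ (WfL⇒Distinct ((x , Top) ∷ Γ) wfΓ) (WfE⇒Unique Θ wfΘ))
⊢tr (Tid {p} {Γρ = Γρ} _ rf r dist) =
  ⊢outputs-aligned (align rf r) p (subst CDistinct (++-identityʳ ⟦ Γρ ⟧C) (⟦⟧-distinct Γρ [] dist []))
⊢tr (Tchop rf r d e wf) = ⊢chop (align rf r) (⊢tr d) (⊢tr e) (⊢-distinct e) (WfE⇒Unique _ wf)
⊢tr (Tsend rf r d) = ⊢send (align rf r) (⊢tr d) (⊢-uniqueEnv d)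
⊢tr (Trecv {Δ = Δ} d x∉) = ⊢recv {Δ = Δ} (⊢tr d) x∉
⊢tr (Texch Θ↭ Γ↭ d) = Cexch (++⁺ (⟦⟧C-↭ Γ↭) (⟦⟧E-↭ Θ↭)) (⊢tr d)

corollary6p2 : ∀ {P Γ} (d : [] ⊢ P ⦂ Γ) → ⊢ᶜ tr d ⦂ ⟦ Γ ⟧C
corollary6p2 {Γ = Γ} d = subst (⊢ᶜ tr d ⦂_) (++-identityʳ ⟦ Γ ⟧C) (⊢tr d)
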